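{- Let $p\ge3$ be prime, $G=E_p(p^3)=\langle a,b,c\mid a^p=b^p=c^p=1,[b,a]=c,[c,a]=1,[c,b]=1\rangle$, and $H=\langle a\rangle$. Then the isomorphism $\partial^{ -1}\circ\delta:H^2(G,J_{G/H})\to H^2(G,\mathbb{Q}/\mathbb{Z})$ maps $\mathrm{Ker}\{H^2(G,J_{G/H})\xrightarrow{\mathrm{res}}H^2(H,J_{G/H})\}$ onto $\langle\overline{f_2}\rangle\simeq\mathbb{Z}/p\mathbb{Z}$.
   Context: $[x,y]=x^{ -1}y^{ -1}xy$; each $g\in G$ is uniquely $a^sb^tc^u$, $0\le s,t,u\le p-1$. $J_{G/H}$ is defined by $0\to\mathbb{Z}\to\mathbb{Z}[G/H]\to J_{G/H}\to0$, $1\mapsto\sum_{gH}gH$; $\delta:H^2(G,J_{G/H})\to H^3(G,\mathbb{Z})$ is its connecting homomorphism (an isomorphism here), and $\partial:H^2(G,\mathbb{Q}/\mathbb{Z})\xrightarrow{\sim}H^3(G,\mathbb{Z})$ is the connecting isomorphism of $0\to\mathbb{Z}\to\mathbb{Q}\to\mathbb{Q}/\mathbb{Z}\to0$. $\overline{f_2}$ is the class of the 2-cocycle $f_2(a^{s_1}b^{t_1}c^{u_1},a^{s_2}b^{t_2}c^{u_2})=\big(\frac{t_1(t_1-1)}{2}s_2+(t_1s_2+u_1)t_2\big)/p\in\mathbb{Q}/\mathbb{Z}$. -}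

module Defs where

open import Data.Nat as ℕ using (ℕ; NonZero)
open import Data.Nat.DivMod using (_mod_)
open import Data.Fin using (Fin; toℕ)
open import Data.Integer as ℤ using (ℤ; +_)
open import Data.Integer.DivMod using (_%ℕ_)
open import Data.Rational as ℚ using (ℚ)
open import Data.Product using (_×_; _,_; ∃)
open import Relation.Binary.PropositionalEquality using (_≡_)

module E (p : ℕ) ⦃ nz : NonZero p ⦄ where

  -- An element a^s b^t c^u (0 ≤ s,t,u ≤ p-1)
  -- is the triple (s , t , u).  From [b,a] = b⁻¹a⁻¹ba = c and c central:
  --   b^t a^s = a^s b^t c^(ts), hence
  --   (a^s1 b^t1 c^u1)(a^s2 b^t2 c^u2) = a^(s1+s2) b^(t1+t2) c^(u1+u2+t1 s2).
  G : Set
  G = Fin p × Fin p × Fin p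

  red : ℤ → Fin p
  red z = (z %ℕ p) mod p

  I : Fin p → ℤ
  I i = + toℕ i

  _·_ : G → G → G
  (s₁ , t₁ , u₁) · (s₂ , t₂ , u₂) =
    red (I s₁ ℤ.+ I s₂) , red (I t₁ ℤ.+ I t₂) , red (I u₁ ℤ.+ I u₂ ℤ.+ I t₁ ℤ.* I s₂)

  inv : G → G
  inv (s , t , u) = red (ℤ.- I s) , red (ℤ.- I t) , red (I t ℤ.* I s ℤ.- I u)

  aPow : Fin p → G
  aPow i = (i , red (+ 0) , red (+ 0))

  -- Since a^s b^t c^u a^k = a^(s+k) b^t c^(u+tk),
  -- each coset gH contains exactly one element b^t c^u, so G/H is
  -- identified with pairs (t , u): coset (a^s b^t c^u)H ↦ (t , u - t s).
  Cos : Set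
  Cos = Fin p × Fin p

  cosetOf : G → Cos
  cosetOf (s , t , u) = t , red (I u ℤ.- I t ℤ.* I s)

  rep : Cos → G
  rep (t , u) = red (+ 0) , t , u

  act : G → Cos → Cos
  act g x = cosetOf (g · rep x)

  -- Z[G/H] as functions G/H → ℤ, with (g·f)(x) = f(g⁻¹x).
  -- The map Z → Z[G/H], 1 ↦ Σ gH, is n ↦ constant function n;
  -- J_{G/H} = Z[G/H] / constants.  A J-valued cochain is represented
  -- by a Z[G/H]-valued lift; equality in J = difference is constant.
  M : Set
  M = Cos → ℤ

  _▷_ : G → M → M
  (g ▷ f) x = f (act (inv g) x)

  IsConst : M → Set
  IsConst f = ∃ λ (k : ℤ) → ∀ x → f x ≡ k

  d1M : (G → M) → G → G → M
  d1M h g₁ g₂ x = (g₁ ▷ h g₂) x ℤ.- h (g₁ · g₂) x ℤ.+ h g₁ x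

  d2M : (G → G → M) → G → G → G → M
  d2M F g₁ g₂ g₃ x =
    (g₁ ▷ F g₂ g₃) x ℤ.- F (g₁ · g₂) g₃ x ℤ.+ F g₁ (g₂ · g₃) x ℤ.- F g₁ g₂ x

  -- F (Z[G/H]-valued lift) represents a 2-cocycle with values in J_{G/H}
  JCocycle : (G → G → M) → Set
  JCocycle F = ∀ g₁ g₂ g₃ → IsConst (d2M F g₁ g₂ g₃)

  -- res : H²(G,J) → H²(H,J) kills [F]:  F|_{H×H} is a J-valued coboundary on H
  ResTrivial : (G → G → M) → Set
  ResTrivial F = ∃ λ (h : G → M) → ∀ i j →
    IsConst (λ x → F (aPow i) (aPow j) x ℤ.- d1M h (aPow i) (aPow j) x)

  -- Q/Z-valued cochains (trivial action), represented by ℚ-valued lifts.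
  IsInt : ℚ → Set
  IsInt q = ∃ λ (k : ℤ) → q ≡ k ℚ./ 1

  d1Q : (G → ℚ) → G → G → ℚ
  d1Q h g₁ g₂ = h g₂ ℚ.- h (g₁ · g₂) ℚ.+ h g₁

  d2Q : (G → G → ℚ) → G → G → G → ℚ
  d2Q ψ g₁ g₂ g₃ = ψ g₂ g₃ ℚ.- ψ (g₁ · g₂) g₃ ℚ.+ ψ g₁ (g₂ · g₃) ℚ.- ψ g₁ g₂

  SameClassQZ : (G → G → ℚ) → (G → G → ℚ) → Set
  SameClassQZ ψ φ = ∃ λ (h : G → ℚ) → ∀ g₁ g₂ →
    IsInt (ψ g₁ g₂ ℚ.- φ g₁ g₂ ℚ.- d1Q h g₁ g₂)

  -- the cocycle f₂ (lifted to ℚ using representatives 0 ≤ s,t,u ≤ p-1)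
  f₂ : G → G → ℚ
  f₂ (s₁ , t₁ , u₁) (s₂ , t₂ , u₂) =
    (+ ((n t₁ ℕ.* (n t₁ ℕ.∸ 1) ℕ./ 2) ℕ.* n s₂ ℕ.+ (n t₁ ℕ.* n s₂ ℕ.+ n u₁) ℕ.* n t₂)) ℚ./ p
    where n = toℕ

  scale : ℕ → (G → G → ℚ) → G → G → ℚ
  scale k φ g₁ g₂ = ((+ k) ℚ./ 1) ℚ.* φ g₁ g₂

  zeroQ : G → G → ℚ
  zeroQ _ _ = ℚ.0ℚ

  -- (∂⁻¹ ∘ δ)[F] = [φ]   ⇔   δ[F] = ∂[φ] in H³(G,Z).
  -- δ[F] is the class of the Z-valued 3-cocycle d2M F (constant values,
  -- Z ⊂ Z[G/H] via constants); ∂[ψ] is the class of d2Q ψ.  These agree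
  -- iff some ℚ-lift ψ of a Q/Z-cocycle cohomologous to φ has d2Q ψ = d2M F
  -- on the nose (an integral discrepancy is absorbed into ψ).
  MapsTo : (G → G → M) → (G → G → ℚ) → Set
  MapsTo F φ = ∃ λ (ψ : G → G → ℚ) → SameClassQZ ψ φ ×
    (∀ g₁ g₂ g₃ x → d2M F g₁ g₂ g₃ x ℚ./ 1 ≡ d2Q ψ g₁ g₂ g₃)

module Submission where

-- For a J-cocycle F, the average ψ = p⁻² Σₓ F(-,-)(x) over the p² cosets is a ℚ-lift of a
-- Q/Z-cocycle with dψ = dF, so ∂⁻¹δ[F] = [ψ].  If res[F] = 0, then on H = ⟨a⟩ the function
-- F(c,-) - F(-,c) is a 1-cocycle up to constants, and telescoping over the powers of a shows
-- that ψ(c,a) - ψ(a,c) is an integer.  Every such class is a multiple of [f₂]: in the extension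
-- of G by Q/Z defined by ψ, lifts A, B, C of a, b, c with Aᵖ = Bᵖ = 1 satisfy CA = AC and
-- CB = BCZ with Z central over 1; then Zᵖ = Cᵖ = 1 (the latter because p is odd), and collecting
-- products of words AˢBᵗCᵘ gives ψ ≡ k·f₂, where Z has coordinate k/p mod Z.  Conversely, for an
-- explicit quadratic Q the cochain f₂ + d(Q/2) is divisible by p in Z[G/H] and vanishes on
-- H × H, so k(f₂ + d(Q/2))/p realises k[f₂].  Finally f₂(c,b) - f₂(b,c) = 1/p is not an
-- integer while p·f₂ is.

open import Defs
open import Data.Nat using (ℕ; NonZero; _≤_)
open import Data.Nat.Primality using (Prime)
open import Data.Product using (_×_; ∃)
open import Relation.Nullary using (¬_)

open import Algebra.Bundles using (Group; Monoid)
import Algebra.Properties.CommutativeMonoid.Sum as CommutativeMonoidSum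
import Algebra.Properties.Group as GroupProperties
open import Algebra.Structures using (IsGroup)
open import Data.Empty using (⊥; ⊥-elim)
open import Data.Fin using (Fin; toℕ)
import Data.Fin.Properties as Fin
open import Data.Fin.Patterns using (0F)
open import Data.Fin.Permutation using (permutation)
open import Data.Integer as ℤ using (ℤ; +_; -[1+_])
import Data.Integer.Properties as ℤ
open import Data.Integer.DivMod using (_%ℕ_; _/ℕ_; a≡a%ℕn+[a/ℕn]*n; n%ℕd<d)
open import Data.Integer.Tactic.RingSolver using (solve-∀; solve)
open import Data.List using (_∷_; [])
open import Data.Maybe using (Maybe; just; nothing)
open import Data.Nat as ℕ using (zero; suc)
import Data.Nat.Properties as ℕ
import Data.Nat.DivMod as ℕ
open import Data.Nat.Divisibility using (divides; hasNonTrivialDivisor)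
import Data.Nat.Tactic.RingSolver as ℕ-Solver
open import Data.Product using (_,_; Σ; proj₁; proj₂)
open import Data.Product.Relation.Binary.Pointwise.NonDependent using (×-setoid)
open import Data.Rational as ℚ using (ℚ; _/_)
import Data.Rational.Properties as ℚ
open import Data.Rational.Unnormalised as ℚᵘ using (mkℚᵘ; *≡*)
import Data.Rational.Unnormalised.Properties as ℚᵘ
open import Data.Vec.Functional using (tail)
open import Level using (0ℓ)
open import Relation.Binary.Bundles using (Setoid)
open import Relation.Binary.PropositionalEquality using (_≡_; refl; sym; trans; cong; cong₂; subst; isEquivalence; module ≡-Reasoning)
import Relation.Binary.Reasoning.Setoid as SetoidReasoning
open import Relation.Nullary using (yes; no)
import Tactic.MonoidSolver as MonoidSolver
import Tactic.RingSolver as RingSolver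
open import Tactic.RingSolver.Core.AlmostCommutativeRing using (AlmostCommutativeRing; fromCommutativeRing)

ℚ-ring : AlmostCommutativeRing 0ℓ 0ℓ
ℚ-ring = fromCommutativeRing ℚ.+-*-commutativeRing is-zero?
  where
  is-zero? : ∀ x → Maybe (ℚ.0ℚ ≡ x)
  is-zero? x with ℚ.0ℚ ℚ.≟ x
  ... | yes e = just e
  ... | no _  = nothing

fromℚᵘ-homo-+ : ∀ u v → ℚ.fromℚᵘ (u ℚᵘ.+ v) ≡ ℚ.fromℚᵘ u ℚ.+ ℚ.fromℚᵘ v
fromℚᵘ-homo-+ u v = begin
  ℚ.fromℚᵘ (u ℚᵘ.+ v)
    ≡⟨ ℚ.fromℚᵘ-cong (ℚᵘ.+-cong (ℚᵘ.≃-sym (ℚ.toℚᵘ-fromℚᵘ u)) (ℚᵘ.≃-sym (ℚ.toℚᵘ-fromℚᵘ v))) ⟩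
  ℚ.fromℚᵘ (ℚ.toℚᵘ (ℚ.fromℚᵘ u) ℚᵘ.+ ℚ.toℚᵘ (ℚ.fromℚᵘ v))
    ≡⟨ ℚ.fromℚᵘ-cong (ℚᵘ.≃-sym (ℚ.toℚᵘ-homo-+ (ℚ.fromℚᵘ u) (ℚ.fromℚᵘ v))) ⟩
  ℚ.fromℚᵘ (ℚ.toℚᵘ (ℚ.fromℚᵘ u ℚ.+ ℚ.fromℚᵘ v))
    ≡⟨ ℚ.fromℚᵘ-toℚᵘ _ ⟩
  ℚ.fromℚᵘ u ℚ.+ ℚ.fromℚᵘ v ∎
  where open ≡-Reasoning

fromℚᵘ-homo-* : ∀ u v → ℚ.fromℚᵘ (u ℚᵘ.* v) ≡ ℚ.fromℚᵘ u ℚ.* ℚ.fromℚᵘ v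
fromℚᵘ-homo-* u v = begin
  ℚ.fromℚᵘ (u ℚᵘ.* v)
    ≡⟨ ℚ.fromℚᵘ-cong (ℚᵘ.*-cong (ℚᵘ.≃-sym (ℚ.toℚᵘ-fromℚᵘ u)) (ℚᵘ.≃-sym (ℚ.toℚᵘ-fromℚᵘ v))) ⟩
  ℚ.fromℚᵘ (ℚ.toℚᵘ (ℚ.fromℚᵘ u) ℚᵘ.* ℚ.toℚᵘ (ℚ.fromℚᵘ v))
    ≡⟨ ℚ.fromℚᵘ-cong (ℚᵘ.≃-sym (ℚ.toℚᵘ-homo-* (ℚ.fromℚᵘ u) (ℚ.fromℚᵘ v))) ⟩
  ℚ.fromℚᵘ (ℚ.toℚᵘ (ℚ.fromℚᵘ u ℚ.* ℚ.fromℚᵘ v))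
    ≡⟨ ℚ.fromℚᵘ-toℚᵘ _ ⟩
  ℚ.fromℚᵘ u ℚ.* ℚ.fromℚᵘ v ∎
  where open ≡-Reasoning

fromℚᵘ-homo‿- : ∀ u → ℚ.fromℚᵘ (ℚᵘ.- u) ≡ ℚ.- ℚ.fromℚᵘ u
fromℚᵘ-homo‿- u = begin
  ℚ.fromℚᵘ (ℚᵘ.- u)                  ≡⟨ ℚ.fromℚᵘ-cong (ℚᵘ.-‿cong (ℚᵘ.≃-sym (ℚ.toℚᵘ-fromℚᵘ u))) ⟩
  ℚ.fromℚᵘ (ℚᵘ.- ℚ.toℚᵘ (ℚ.fromℚᵘ u)) ≡⟨ ℚ.fromℚᵘ-cong (ℚᵘ.≃-sym (ℚ.toℚᵘ-homo‿- (ℚ.fromℚᵘ u))) ⟩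
  ℚ.fromℚᵘ (ℚ.toℚᵘ (ℚ.- ℚ.fromℚᵘ u))  ≡⟨ ℚ.fromℚᵘ-toℚᵘ _ ⟩
  ℚ.- ℚ.fromℚᵘ u                      ∎
  where open ≡-Reasoning

fromℤ : ℤ → ℚ
fromℤ z = z / 1

fromℤ-+ : ∀ x y → fromℤ (x ℤ.+ y) ≡ fromℤ x ℚ.+ fromℤ y
fromℤ-+ x y = trans (ℚ.fromℚᵘ-cong {mkℚᵘ (x ℤ.+ y) 0} {mkℚᵘ x 0 ℚᵘ.+ mkℚᵘ y 0} (*≡* (eq x y))) (fromℚᵘ-homo-+ (mkℚᵘ x 0) (mkℚᵘ y 0))
  where
  eq : ∀ x y → (x ℤ.+ y) ℤ.* + 1 ≡ (x ℤ.* + 1 ℤ.+ y ℤ.* + 1) ℤ.* + 1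
  eq = solve-∀

fromℤ-* : ∀ x y → fromℤ (x ℤ.* y) ≡ fromℤ x ℚ.* fromℤ y
fromℤ-* x y = fromℚᵘ-homo-* (mkℚᵘ x 0) (mkℚᵘ y 0)

fromℤ-neg : ∀ x → fromℤ (ℤ.- x) ≡ ℚ.- fromℤ x
fromℤ-neg x = fromℚᵘ-homo‿- (mkℚᵘ x 0)

fromℤ-- : ∀ x y → fromℤ (x ℤ.- y) ≡ fromℤ x ℚ.- fromℤ y
fromℤ-- x y = trans (fromℤ-+ x (ℤ.- y)) (cong (fromℤ x ℚ.+_) (fromℤ-neg y))

fromℤ-alternating : ∀ a b c d → fromℤ (a ℤ.- b ℤ.+ c ℤ.- d) ≡ fromℤ a ℚ.- fromℤ b ℚ.+ fromℤ c ℚ.- fromℤ d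
fromℤ-alternating a b c d =
  trans (fromℤ-- (a ℤ.- b ℤ.+ c) d) (cong (ℚ._- fromℤ d) (trans (fromℤ-+ (a ℤ.- b) c) (cong (ℚ._+ fromℤ c) (fromℤ-- a b))))

fromℤ-injective : ∀ {x y} → fromℤ x ≡ fromℤ y → x ≡ y
fromℤ-injective {x} {y} e with ℚ.fromℚᵘ-injective {mkℚᵘ x 0} {mkℚᵘ y 0} e
... | *≡* x*1≡y*1 = trans (sym (ℤ.*-identityʳ x)) (trans x*1≡y*1 (ℤ.*-identityʳ y))

/-as-* : ∀ z d .⦃ _ : NonZero d ⦄ → z / d ≡ fromℤ z ℚ.* (+ 1 / d)
/-as-* z (suc d) = trans (ℚ.fromℚᵘ-cong {mkℚᵘ z d} {mkℚᵘ z 0 ℚᵘ.* mkℚᵘ (+ 1) d} (*≡* (eq z (+ suc d))))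
                         (fromℚᵘ-homo-* (mkℚᵘ z 0) (mkℚᵘ (+ 1) d))
  where
  eq : ∀ z D → z ℤ.* (+ 1 ℤ.* D) ≡ (z ℤ.* + 1) ℤ.* D
  eq = solve-∀

1/d*d≡1 : ∀ d .⦃ _ : NonZero d ⦄ → (+ 1 / d) ℚ.* fromℤ (+ d) ≡ ℚ.1ℚ
1/d*d≡1 (suc d) = trans (sym (fromℚᵘ-homo-* (mkℚᵘ (+ 1) d) (mkℚᵘ (+ suc d) 0)))
                        (ℚ.fromℚᵘ-cong {mkℚᵘ (+ 1) d ℚᵘ.* mkℚᵘ (+ suc d) 0} {mkℚᵘ (+ 1) 0} (*≡* (eq (+ suc d))))
  where
  eq : ∀ D → (+ 1 ℤ.* D) ℤ.* + 1 ≡ + 1 ℤ.* (D ℤ.* + 1)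
  eq = solve-∀

-- IsInt of Defs, which is only available inside the module E p
Integral : ℚ → Set
Integral q = ∃ λ (k : ℤ) → q ≡ fromℤ k

integral-fromℤ : ∀ k → Integral (fromℤ k)
integral-fromℤ k = k , refl

integral-0 : Integral ℚ.0ℚ
integral-0 = integral-fromℤ (+ 0)

integral-+ : ∀ {a b} → Integral a → Integral b → Integral (a ℚ.+ b)
integral-+ (k , refl) (j , refl) = k ℤ.+ j , sym (fromℤ-+ k j)

integral-neg : ∀ {a} → Integral a → Integral (ℚ.- a)
integral-neg (k , refl) = ℤ.- k , sym (fromℤ-neg k)

integral-- : ∀ {a b} → Integral a → Integral b → Integral (a ℚ.- b)
integral-- ia ib = integral-+ ia (integral-neg ib)

integral-*ℤ : ∀ {a} k → Integral a → Integral (fromℤ k ℚ.* a)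
integral-*ℤ k (j , refl) = k ℤ.* j , sym (fromℤ-* k j)

multiple-integral⇒≡k/d : ∀ d .⦃ _ : NonZero d ⦄ {x} → Integral (fromℤ (+ d) ℚ.* x) →
                          ∃ λ (k : ℕ) → Integral (x ℚ.- fromℤ (+ k) ℚ.* (+ 1 / d))
multiple-integral⇒≡k/d d {x} (m , d*x≡m) = k , q , (begin
  x ℚ.- K ℚ.* w                                                 ≡⟨ split x w D K Q ⟩
  (ℚ.1ℚ ℚ.- w ℚ.* D) ℚ.* x ℚ.+ w ℚ.* (D ℚ.* x ℚ.- (K ℚ.+ Q ℚ.* D)) ℚ.+ Q ℚ.* (w ℚ.* D)
    ≡⟨ cong₂ (λ u v → (ℚ.1ℚ ℚ.- u) ℚ.* x ℚ.+ w ℚ.* v ℚ.+ Q ℚ.* u) (1/d*d≡1 d) D*x≡K+Q*D ⟩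
  (ℚ.1ℚ ℚ.- ℚ.1ℚ) ℚ.* x ℚ.+ w ℚ.* (K ℚ.+ Q ℚ.* D ℚ.- (K ℚ.+ Q ℚ.* D)) ℚ.+ Q ℚ.* ℚ.1ℚ
    ≡⟨ collapse x w (K ℚ.+ Q ℚ.* D) Q ⟩
  Q                                                             ∎)
  where
  open ≡-Reasoning
  k = m %ℕ d
  q = m /ℕ d
  w = + 1 / d
  D = fromℤ (+ d)
  K = fromℤ (+ k)
  Q = fromℤ q
  D*x≡K+Q*D : D ℚ.* x ℚ.- (K ℚ.+ Q ℚ.* D) ≡ K ℚ.+ Q ℚ.* D ℚ.- (K ℚ.+ Q ℚ.* D)
  D*x≡K+Q*D = cong (ℚ._- (K ℚ.+ Q ℚ.* D))
    (trans d*x≡m (trans (cong fromℤ (a≡a%ℕn+[a/ℕn]*n m d)) (trans (fromℤ-+ (+ k) (q ℤ.* + d)) (cong (K ℚ.+_) (fromℤ-* q (+ d))))))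
  split : ∀ x w D K Q → x ℚ.- K ℚ.* w ≡ (ℚ.1ℚ ℚ.- w ℚ.* D) ℚ.* x ℚ.+ w ℚ.* (D ℚ.* x ℚ.- (K ℚ.+ Q ℚ.* D)) ℚ.+ Q ℚ.* (w ℚ.* D)
  split = RingSolver.solve-∀ ℚ-ring
  collapse : ∀ x w R Q → (ℚ.1ℚ ℚ.- ℚ.1ℚ) ℚ.* x ℚ.+ w ℚ.* (R ℚ.- R) ℚ.+ Q ℚ.* ℚ.1ℚ ≡ Q
  collapse = RingSolver.solve-∀ ℚ-ring

n*k/n≡k : ∀ n .⦃ _ : NonZero n ⦄ k → fromℤ (+ n ℤ.* k) ℚ.* (+ 1 / n) ≡ fromℤ k
n*k/n≡k n k = begin
  fromℤ (+ n ℤ.* k) ℚ.* (+ 1 / n)            ≡⟨ cong (ℚ._* (+ 1 / n)) (fromℤ-* (+ n) k) ⟩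
  fromℤ (+ n) ℚ.* fromℤ k ℚ.* (+ 1 / n)      ≡⟨ rearrange (fromℤ (+ n)) (fromℤ k) (+ 1 / n) ⟩
  fromℤ k ℚ.* ((+ 1 / n) ℚ.* fromℤ (+ n))    ≡⟨ cong (fromℤ k ℚ.*_) (1/d*d≡1 n) ⟩
  fromℤ k ℚ.* ℚ.1ℚ                            ≡⟨ ℚ.*-identityʳ (fromℤ k) ⟩
  fromℤ k                                     ∎
  where
  open ≡-Reasoning
  rearrange : ∀ a b w → a ℚ.* b ℚ.* w ≡ b ℚ.* (w ℚ.* a)
  rearrange = RingSolver.solve-∀ ℚ-ring

1/d-not-integral : ∀ d .⦃ _ : NonZero d ⦄ → 1 ℕ.< d → ¬ Integral (+ 1 / d)
1/d-not-integral d 1<d (k , 1/d≡k) = ℕ.<-irrefl (sym d≡1) 1<d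
  where
  1≡k*d : + 1 ≡ k ℤ.* + d
  1≡k*d = fromℤ-injective (trans (sym (1/d*d≡1 d)) (trans (cong (ℚ._* fromℤ (+ d)) 1/d≡k) (sym (fromℤ-* k (+ d)))))
  d≡1 : d ≡ 1
  d≡1 = ℕ.m*n≡1⇒n≡1 ℤ.∣ k ∣ d (sym (trans (cong ℤ.∣_∣ 1≡k*d) (ℤ.abs-* k (+ d))))

-- Triangular numbers and odd primes

tri : ℕ → ℕ
tri zero    = 0
tri (suc j) = tri j ℕ.+ j

tri*2 : ∀ t → tri t ℕ.* 2 ≡ t ℕ.* (t ℕ.∸ 1)
tri*2 zero          = refl
tri*2 (suc zero)    = refl
tri*2 (suc (suc t)) = begin
  (tri (suc t) ℕ.+ suc t) ℕ.* 2         ≡⟨ ℕ.*-distribʳ-+ 2 (tri (suc t)) (suc t) ⟩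
  tri (suc t) ℕ.* 2 ℕ.+ suc t ℕ.* 2     ≡⟨ cong (ℕ._+ suc t ℕ.* 2) (tri*2 (suc t)) ⟩
  suc t ℕ.* t ℕ.+ suc t ℕ.* 2           ≡⟨ ℕ-Solver.solve (t ∷ []) ⟩
  suc (suc t) ℕ.* suc t                 ∎
  where open ≡-Reasoning

t*[t∸1]/2≡tri : ∀ t → t ℕ.* (t ℕ.∸ 1) ℕ./ 2 ≡ tri t
t*[t∸1]/2≡tri t = trans (cong (ℕ._/ 2) (sym (tri*2 t))) (ℕ.m*n/n≡m (tri t) 2)

tri-odd : ∀ {n h} → n ≡ suc (h ℕ.+ h) → tri n ≡ h ℕ.* n
tri-odd {h = h} refl = ℕ.*-cancelʳ-≡ _ _ 2 (trans (tri*2 (suc (h ℕ.+ h))) (double h))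
  where
  double : ∀ h → suc (h ℕ.+ h) ℕ.* (h ℕ.+ h) ≡ h ℕ.* suc (h ℕ.+ h) ℕ.* 2
  double = ℕ-Solver.solve-∀

2*tri : ∀ t → + 2 ℤ.* + tri t ≡ + t ℤ.* (+ t ℤ.- + 1)
2*tri zero    = refl
2*tri (suc t) = begin
  + 2 ℤ.* (+ tri t ℤ.+ + t)               ≡⟨ ℤ.*-distribˡ-+ (+ 2) (+ tri t) (+ t) ⟩
  + 2 ℤ.* + tri t ℤ.+ + 2 ℤ.* + t         ≡⟨ cong (ℤ._+ + 2 ℤ.* + t) (2*tri t) ⟩
  + t ℤ.* (+ t ℤ.- + 1) ℤ.+ + 2 ℤ.* + t   ≡⟨ step (+ t) ⟩
  + suc t ℤ.* (+ suc t ℤ.- + 1)           ∎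
  where
  open ≡-Reasoning
  step : ∀ t → t ℤ.* (t ℤ.- + 1) ℤ.+ + 2 ℤ.* t ≡ (+ 1 ℤ.+ t) ℤ.* (+ 1 ℤ.+ t ℤ.- + 1)
  step = solve-∀

prime≥3⇒odd : ∀ {p} → Prime p → 3 ℕ.≤ p → ∃ λ h → p ≡ suc (h ℕ.+ h)
prime≥3⇒odd {p} p-prime 3≤p with p ℕ.% 2 | ℕ.m%n<n p 2 | ℕ.m≡m%n+[m/n]*n p 2
... | 0 | _ | p≡[p/2]*2 = ⊥-elim (Prime.notComposite p-prime (hasNonTrivialDivisor 3≤p (divides (p ℕ./ 2) p≡[p/2]*2)))
... | 1 | _ | p≡1+[p/2]*2 = p ℕ./ 2 , trans p≡1+[p/2]*2 (cong suc (trans (ℕ.*-comm (p ℕ./ 2) 2) (cong (p ℕ./ 2 ℕ.+_) (ℕ.+-identityʳ (p ℕ./ 2)))))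
... | suc (suc _) | ℕ.s≤s (ℕ.s≤s ()) | _

module Congruence (P : ℤ) where
  open import Data.Integer.Base using (_+_; _*_; -_; _-_)

  infix 4 _≈_
  record _≈_ (x y : ℤ) : Set where
    constructor mk≈
    field
      quotient : ℤ
      eq       : x ≡ y + quotient * P

  ≈-refl : ∀ {x} → x ≈ x
  ≈-refl {x} = mk≈ (+ 0) (solve (x ∷ P ∷ []))

  ≈-reflexive : ∀ {x y} → x ≡ y → x ≈ y
  ≈-reflexive refl = ≈-refl

  ≈-sym : ∀ {x y} → x ≈ y → y ≈ x
  ≈-sym {y = y} (mk≈ k refl) = mk≈ (- k) (solve (y ∷ k ∷ P ∷ []))

  ≈-trans : ∀ {x y z} → x ≈ y → y ≈ z → x ≈ z
  ≈-trans {z = z} (mk≈ k refl) (mk≈ j refl) = mk≈ (j + k) (solve (z ∷ j ∷ k ∷ P ∷ []))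

  +-cong : ∀ {x y u v} → x ≈ y → u ≈ v → x + u ≈ y + v
  +-cong {y = y} {v = v} (mk≈ k refl) (mk≈ j refl) = mk≈ (k + j) (solve (y ∷ v ∷ k ∷ j ∷ P ∷ []))

  *-cong : ∀ {x y u v} → x ≈ y → u ≈ v → x * u ≈ y * v
  *-cong {y = y} {v = v} (mk≈ k refl) (mk≈ j refl) =
    mk≈ (k * v + y * j + k * j * P) (solve (y ∷ v ∷ k ∷ j ∷ P ∷ []))

  neg-cong : ∀ {x y} → x ≈ y → - x ≈ - y
  neg-cong {y = y} (mk≈ k refl) = mk≈ (- k) (solve (y ∷ k ∷ P ∷ []))

  −-cong : ∀ {x y u v} → x ≈ y → u ≈ v → x - u ≈ y - v
  −-cong x≈y u≈v = +-cong x≈y (neg-cong u≈v)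

  multiple≈0 : ∀ k → k * P ≈ + 0
  multiple≈0 k = mk≈ k (solve (k ∷ P ∷ []))

  ≈-setoid : Setoid _ _
  ≈-setoid = record
    { Carrier = ℤ ; _≈_ = _≈_
    ; isEquivalence = record { refl = ≈-refl ; sym = ≈-sym ; trans = ≈-trans } }

module MonoidPowers {c ℓ} (M : Monoid c ℓ) where
  open Monoid M renaming (refl to ≈-refl; sym to ≈-sym; trans to ≈-trans)
  import Algebra.Properties.Monoid.Mult M as Mult

  infixr 8 _^_
  _^_ : Carrier → ℕ → Carrier
  x ^ n = n Mult.× x

  ^-homo-+ : ∀ x m n → x ^ (m ℕ.+ n) ≈ x ^ m ∙ x ^ n
  ^-homo-+ = Mult.×-homo-+

  ^-congˡ : ∀ n {x y} → x ≈ y → x ^ n ≈ y ^ n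
  ^-congˡ = Mult.×-congʳ

  ^-sucʳ : ∀ x n → x ^ suc n ≈ x ^ n ∙ x
  ^-sucʳ x n = begin
    x ^ suc n          ≡⟨ cong (x ^_) (ℕ.+-comm 1 n) ⟩
    x ^ (n ℕ.+ 1)      ≈⟨ ^-homo-+ x n 1 ⟩
    x ^ n ∙ x ^ 1      ≈⟨ ∙-congˡ (Mult.×-homo-1 x) ⟩
    x ^ n ∙ x          ∎
    where open SetoidReasoning setoid

  ^-*-assoc : ∀ x m n → (x ^ n) ^ m ≈ x ^ (m ℕ.* n)
  ^-*-assoc x m n = Mult.×-assocˡ x m n

  ε^n≈ε : ∀ n → ε ^ n ≈ ε
  ε^n≈ε zero    = ≈-refl
  ε^n≈ε (suc n) = ≈-trans (identityˡ _) (ε^n≈ε n)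

  ^-*≈ε : ∀ {x n} → x ^ n ≈ ε → ∀ m → x ^ (m ℕ.* n) ≈ ε
  ^-*≈ε {x} {n} xⁿ≈ε m = ≈-trans (≈-sym (^-*-assoc x m n)) (≈-trans (^-congˡ m xⁿ≈ε) (ε^n≈ε m))

  ^-% : ∀ {x n} .⦃ _ : NonZero n ⦄ → x ^ n ≈ ε → ∀ k → x ^ k ≈ x ^ (k ℕ.% n)
  ^-% {x} {n} xⁿ≈ε k = begin
    x ^ k                                   ≡⟨ cong (x ^_) (ℕ.m≡m%n+[m/n]*n k n) ⟩
    x ^ (k ℕ.% n ℕ.+ (k ℕ./ n) ℕ.* n)       ≈⟨ ^-homo-+ x (k ℕ.% n) _ ⟩
    x ^ (k ℕ.% n) ∙ x ^ ((k ℕ./ n) ℕ.* n)   ≈⟨ ∙-congˡ (^-*≈ε xⁿ≈ε (k ℕ./ n)) ⟩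
    x ^ (k ℕ.% n) ∙ ε                       ≈⟨ identityʳ _ ⟩
    x ^ (k ℕ.% n)                           ∎
    where open SetoidReasoning setoid

  commutes-^ : ∀ {x y} → x ∙ y ≈ y ∙ x → ∀ n → x ^ n ∙ y ≈ y ∙ x ^ n
  commutes-^ {x} {y} xy≈yx zero    = ≈-trans (identityˡ y) (≈-sym (identityʳ y))
  commutes-^ {x} {y} xy≈yx (suc n) = begin
    (x ∙ x ^ n) ∙ y  ≈⟨ assoc x (x ^ n) y ⟩
    x ∙ (x ^ n ∙ y)  ≈⟨ ∙-congˡ (commutes-^ xy≈yx n) ⟩
    x ∙ (y ∙ x ^ n)  ≈⟨ ≈-sym (assoc x y (x ^ n)) ⟩
    (x ∙ y) ∙ x ^ n  ≈⟨ ∙-congʳ xy≈yx ⟩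
    (y ∙ x) ∙ x ^ n  ≈⟨ assoc y x (x ^ n) ⟩
    y ∙ (x ∙ x ^ n)  ∎
    where open SetoidReasoning setoid

-- Collection in a monoid with Heisenberg relations

module HeisenbergCollection {c ℓ} (M : Monoid c ℓ) where
  open Monoid M renaming (refl to ≈-refl; sym to ≈-sym; trans to ≈-trans; reflexive to ≈-reflexive)
  open MonoidPowers M
  open SetoidReasoning setoid

  module Relations (A B C Z : Carrier)
    (B∙A≈A∙B∙C : B ∙ A ≈ (A ∙ B) ∙ C) (C∙A≈A∙C : C ∙ A ≈ A ∙ C) (C∙B≈B∙C∙Z : C ∙ B ≈ (B ∙ C) ∙ Z)
    (Z-central : ∀ x → Z ∙ x ≈ x ∙ Z) where

    Zⁿ-central : ∀ n x → Z ^ n ∙ x ≈ x ∙ Z ^ n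
    Zⁿ-central n x = commutes-^ (Z-central x) n

    Cᵏ∙A : ∀ k → C ^ k ∙ A ≈ A ∙ C ^ k
    Cᵏ∙A = commutes-^ C∙A≈A∙C

    Cᵏ∙B : ∀ k → C ^ k ∙ B ≈ (B ∙ C ^ k) ∙ Z ^ k
    Cᵏ∙B zero    = MonoidSolver.solve M
    Cᵏ∙B (suc k) = begin
      (C ∙ C ^ k) ∙ B                   ≈⟨ MonoidSolver.solve M ⟩
      C ∙ (C ^ k ∙ B)                   ≈⟨ ∙-congˡ (Cᵏ∙B k) ⟩
      C ∙ ((B ∙ C ^ k) ∙ Z ^ k)         ≈⟨ MonoidSolver.solve M ⟩
      ((C ∙ B) ∙ C ^ k) ∙ Z ^ k         ≈⟨ ∙-congʳ (∙-congʳ C∙B≈B∙C∙Z) ⟩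
      (((B ∙ C) ∙ Z) ∙ C ^ k) ∙ Z ^ k   ≈⟨ MonoidSolver.solve M ⟩
      ((B ∙ C) ∙ (Z ∙ C ^ k)) ∙ Z ^ k   ≈⟨ ∙-congʳ (∙-congˡ (Z-central (C ^ k))) ⟩
      ((B ∙ C) ∙ (C ^ k ∙ Z)) ∙ Z ^ k   ≈⟨ MonoidSolver.solve M ⟩
      (B ∙ (C ∙ C ^ k)) ∙ (Z ∙ Z ^ k)   ∎

    C∙Bʲ : ∀ j → C ∙ B ^ j ≈ (B ^ j ∙ C) ∙ Z ^ j
    C∙Bʲ zero    = MonoidSolver.solve M
    C∙Bʲ (suc j) = begin
      C ∙ (B ∙ B ^ j)                   ≈⟨ MonoidSolver.solve M ⟩
      (C ∙ B) ∙ B ^ j                   ≈⟨ ∙-congʳ C∙B≈B∙C∙Z ⟩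
      ((B ∙ C) ∙ Z) ∙ B ^ j             ≈⟨ MonoidSolver.solve M ⟩
      (B ∙ C) ∙ (Z ∙ B ^ j)             ≈⟨ ∙-congˡ (Z-central (B ^ j)) ⟩
      (B ∙ C) ∙ (B ^ j ∙ Z)             ≈⟨ MonoidSolver.solve M ⟩
      B ∙ (C ∙ B ^ j) ∙ Z               ≈⟨ ∙-congʳ (∙-congˡ (C∙Bʲ j)) ⟩
      B ∙ ((B ^ j ∙ C) ∙ Z ^ j) ∙ Z     ≈⟨ MonoidSolver.solve M ⟩
      ((B ∙ B ^ j) ∙ C) ∙ (Z ^ j ∙ Z)   ≈⟨ ∙-congˡ (≈-sym (^-sucʳ Z j)) ⟩
      ((B ∙ B ^ j) ∙ C) ∙ Z ^ suc j     ∎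

    Bʲ∙A : ∀ j → B ^ j ∙ A ≈ ((A ∙ B ^ j) ∙ C ^ j) ∙ Z ^ tri j
    Bʲ∙A zero    = MonoidSolver.solve M
    Bʲ∙A (suc j) = begin
      (B ∙ B ^ j) ∙ A                                        ≈⟨ MonoidSolver.solve M ⟩
      B ∙ (B ^ j ∙ A)                                        ≈⟨ ∙-congˡ (Bʲ∙A j) ⟩
      B ∙ (((A ∙ B ^ j) ∙ C ^ j) ∙ Z ^ tri j)                ≈⟨ MonoidSolver.solve M ⟩
      (((B ∙ A) ∙ B ^ j) ∙ C ^ j) ∙ Z ^ tri j                ≈⟨ ∙-congʳ (∙-congʳ (∙-congʳ B∙A≈A∙B∙C)) ⟩
      ((((A ∙ B) ∙ C) ∙ B ^ j) ∙ C ^ j) ∙ Z ^ tri j          ≈⟨ MonoidSolver.solve M ⟩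
      ((A ∙ B) ∙ (C ∙ B ^ j)) ∙ (C ^ j ∙ Z ^ tri j)          ≈⟨ ∙-congʳ (∙-congˡ (C∙Bʲ j)) ⟩
      ((A ∙ B) ∙ ((B ^ j ∙ C) ∙ Z ^ j)) ∙ (C ^ j ∙ Z ^ tri j) ≈⟨ MonoidSolver.solve M ⟩
      ((A ∙ (B ∙ B ^ j)) ∙ C) ∙ ((Z ^ j ∙ C ^ j) ∙ Z ^ tri j) ≈⟨ ∙-congˡ (∙-congʳ (Zⁿ-central j (C ^ j))) ⟩
      ((A ∙ (B ∙ B ^ j)) ∙ C) ∙ ((C ^ j ∙ Z ^ j) ∙ Z ^ tri j) ≈⟨ MonoidSolver.solve M ⟩
      ((A ∙ (B ∙ B ^ j)) ∙ (C ∙ C ^ j)) ∙ (Z ^ j ∙ Z ^ tri j) ≈⟨ ∙-congˡ (≈-sym (^-homo-+ Z j (tri j))) ⟩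
      ((A ∙ (B ∙ B ^ j)) ∙ (C ∙ C ^ j)) ∙ Z ^ (j ℕ.+ tri j)   ≈⟨ ∙-congˡ (≈-reflexive (cong (Z ^_) (ℕ.+-comm j (tri j)))) ⟩
      ((A ∙ (B ∙ B ^ j)) ∙ (C ∙ C ^ j)) ∙ Z ^ tri (suc j)     ∎

    word : ℕ → ℕ → ℕ → Carrier
    word i j k = (A ^ i ∙ B ^ j) ∙ C ^ k

    nf : ℕ → ℕ → ℕ → ℕ → Carrier
    nf i j k l = word i j k ∙ Z ^ l

    nf-cong : ∀ {i j k l i′ j′ k′ l′} → i ≡ i′ → j ≡ j′ → k ≡ k′ → l ≡ l′ → nf i j k l ≈ nf i′ j′ k′ l′
    nf-cong refl refl refl refl = ≈-refl

    nf∙A : ∀ i j k l → nf i j k l ∙ A ≈ nf (suc i) j (j ℕ.+ k) (tri j ℕ.+ l)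
    nf∙A i j k l = begin
      (((A ^ i ∙ B ^ j) ∙ C ^ k) ∙ Z ^ l) ∙ A                              ≈⟨ MonoidSolver.solve M ⟩
      ((A ^ i ∙ B ^ j) ∙ C ^ k) ∙ (Z ^ l ∙ A)                              ≈⟨ ∙-congˡ (Zⁿ-central l A) ⟩
      ((A ^ i ∙ B ^ j) ∙ C ^ k) ∙ (A ∙ Z ^ l)                              ≈⟨ MonoidSolver.solve M ⟩
      ((A ^ i ∙ B ^ j) ∙ (C ^ k ∙ A)) ∙ Z ^ l                              ≈⟨ ∙-congʳ (∙-congˡ (Cᵏ∙A k)) ⟩
      ((A ^ i ∙ B ^ j) ∙ (A ∙ C ^ k)) ∙ Z ^ l                              ≈⟨ MonoidSolver.solve M ⟩
      ((A ^ i ∙ (B ^ j ∙ A)) ∙ C ^ k) ∙ Z ^ l                              ≈⟨ ∙-congʳ (∙-congʳ (∙-congˡ (Bʲ∙A j))) ⟩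
      ((A ^ i ∙ (((A ∙ B ^ j) ∙ C ^ j) ∙ Z ^ tri j)) ∙ C ^ k) ∙ Z ^ l      ≈⟨ MonoidSolver.solve M ⟩
      (((A ^ i ∙ A) ∙ B ^ j) ∙ C ^ j) ∙ ((Z ^ tri j ∙ C ^ k) ∙ Z ^ l)      ≈⟨ ∙-congˡ (∙-congʳ (Zⁿ-central (tri j) (C ^ k))) ⟩
      (((A ^ i ∙ A) ∙ B ^ j) ∙ C ^ j) ∙ ((C ^ k ∙ Z ^ tri j) ∙ Z ^ l)      ≈⟨ MonoidSolver.solve M ⟩
      (((A ^ i ∙ A) ∙ B ^ j) ∙ (C ^ j ∙ C ^ k)) ∙ (Z ^ tri j ∙ Z ^ l)      ≈⟨ ≈-sym (∙-cong (∙-cong (∙-congʳ (^-sucʳ A i)) (^-homo-+ C j k)) (^-homo-+ Z (tri j) l)) ⟩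
      ((A ^ suc i ∙ B ^ j) ∙ C ^ (j ℕ.+ k)) ∙ Z ^ (tri j ℕ.+ l)            ∎

    nf∙B : ∀ i j k l → nf i j k l ∙ B ≈ nf i (suc j) k (k ℕ.+ l)
    nf∙B i j k l = begin
      (((A ^ i ∙ B ^ j) ∙ C ^ k) ∙ Z ^ l) ∙ B                  ≈⟨ MonoidSolver.solve M ⟩
      ((A ^ i ∙ B ^ j) ∙ C ^ k) ∙ (Z ^ l ∙ B)                  ≈⟨ ∙-congˡ (Zⁿ-central l B) ⟩
      ((A ^ i ∙ B ^ j) ∙ C ^ k) ∙ (B ∙ Z ^ l)                  ≈⟨ MonoidSolver.solve M ⟩
      ((A ^ i ∙ B ^ j) ∙ (C ^ k ∙ B)) ∙ Z ^ l                  ≈⟨ ∙-congʳ (∙-congˡ (Cᵏ∙B k)) ⟩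
      ((A ^ i ∙ B ^ j) ∙ ((B ∙ C ^ k) ∙ Z ^ k)) ∙ Z ^ l        ≈⟨ MonoidSolver.solve M ⟩
      ((A ^ i ∙ (B ^ j ∙ B)) ∙ C ^ k) ∙ (Z ^ k ∙ Z ^ l)        ≈⟨ ≈-sym (∙-cong (∙-congʳ (∙-congˡ (^-sucʳ B j))) (^-homo-+ Z k l)) ⟩
      ((A ^ i ∙ B ^ suc j) ∙ C ^ k) ∙ Z ^ (k ℕ.+ l)            ∎

    nf∙C : ∀ i j k l → nf i j k l ∙ C ≈ nf i j (suc k) l
    nf∙C i j k l = begin
      (((A ^ i ∙ B ^ j) ∙ C ^ k) ∙ Z ^ l) ∙ C   ≈⟨ MonoidSolver.solve M ⟩
      ((A ^ i ∙ B ^ j) ∙ C ^ k) ∙ (Z ^ l ∙ C)   ≈⟨ ∙-congˡ (Zⁿ-central l C) ⟩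
      ((A ^ i ∙ B ^ j) ∙ C ^ k) ∙ (C ∙ Z ^ l)   ≈⟨ MonoidSolver.solve M ⟩
      ((A ^ i ∙ B ^ j) ∙ (C ^ k ∙ C)) ∙ Z ^ l   ≈⟨ ∙-congʳ (∙-congˡ (≈-sym (^-sucʳ C k))) ⟩
      ((A ^ i ∙ B ^ j) ∙ C ^ suc k) ∙ Z ^ l     ∎

    nf∙Aˢ : ∀ s i j k l → nf i j k l ∙ A ^ s ≈ nf (s ℕ.+ i) j (s ℕ.* j ℕ.+ k) (s ℕ.* tri j ℕ.+ l)
    nf∙Aˢ zero    i j k l = identityʳ _
    nf∙Aˢ (suc s) i j k l = begin
      nf i j k l ∙ (A ∙ A ^ s)   ≈⟨ ≈-sym (assoc _ _ _) ⟩
      (nf i j k l ∙ A) ∙ A ^ s   ≈⟨ ∙-congʳ (nf∙A i j k l) ⟩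
      nf (suc i) j (j ℕ.+ k) (tri j ℕ.+ l) ∙ A ^ s ≈⟨ nf∙Aˢ s (suc i) j (j ℕ.+ k) (tri j ℕ.+ l) ⟩
      nf (s ℕ.+ suc i) j (s ℕ.* j ℕ.+ (j ℕ.+ k)) (s ℕ.* tri j ℕ.+ (tri j ℕ.+ l))
        ≈⟨ nf-cong (ℕ.+-suc s i) (refl {x = j}) (exponent s j k) (exponent s (tri j) l) ⟩
      nf (suc s ℕ.+ i) j (suc s ℕ.* j ℕ.+ k) (suc s ℕ.* tri j ℕ.+ l) ∎
      where
      exponent : ∀ s j k → s ℕ.* j ℕ.+ (j ℕ.+ k) ≡ suc s ℕ.* j ℕ.+ k
      exponent = ℕ-Solver.solve-∀

    nf∙Bᵗ : ∀ t i j k l → nf i j k l ∙ B ^ t ≈ nf i (t ℕ.+ j) k (t ℕ.* k ℕ.+ l)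
    nf∙Bᵗ zero    i j k l = identityʳ _
    nf∙Bᵗ (suc t) i j k l = begin
      nf i j k l ∙ (B ∙ B ^ t)                       ≈⟨ ≈-sym (assoc _ _ _) ⟩
      (nf i j k l ∙ B) ∙ B ^ t                       ≈⟨ ∙-congʳ (nf∙B i j k l) ⟩
      nf i (suc j) k (k ℕ.+ l) ∙ B ^ t               ≈⟨ nf∙Bᵗ t i (suc j) k (k ℕ.+ l) ⟩
      nf i (t ℕ.+ suc j) k (t ℕ.* k ℕ.+ (k ℕ.+ l))   ≈⟨ nf-cong (refl {x = i}) (ℕ.+-suc t j) (refl {x = k}) (exponent t k l) ⟩
      nf i (suc t ℕ.+ j) k (suc t ℕ.* k ℕ.+ l)       ∎
      where
      exponent : ∀ t k l → t ℕ.* k ℕ.+ (k ℕ.+ l) ≡ suc t ℕ.* k ℕ.+ l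
      exponent = ℕ-Solver.solve-∀

    nf∙Cᵘ : ∀ u i j k l → nf i j k l ∙ C ^ u ≈ nf i j (u ℕ.+ k) l
    nf∙Cᵘ zero    i j k l = identityʳ _
    nf∙Cᵘ (suc u) i j k l = begin
      nf i j k l ∙ (C ∙ C ^ u)       ≈⟨ ≈-sym (assoc _ _ _) ⟩
      (nf i j k l ∙ C) ∙ C ^ u       ≈⟨ ∙-congʳ (nf∙C i j k l) ⟩
      nf i j (suc k) l ∙ C ^ u       ≈⟨ nf∙Cᵘ u i j (suc k) l ⟩
      nf i j (u ℕ.+ suc k) l         ≈⟨ nf-cong (refl {x = i}) (refl {x = j}) (ℕ.+-suc u k) (refl {x = l}) ⟩
      nf i j (suc u ℕ.+ k) l         ∎

    word-∙ : ∀ i j k s t u →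
      word i j k ∙ word s t u ≈ word (s ℕ.+ i) (t ℕ.+ j) (u ℕ.+ (s ℕ.* j ℕ.+ k)) ∙ Z ^ (tri j ℕ.* s ℕ.+ (j ℕ.* s ℕ.+ k) ℕ.* t)
    word-∙ i j k s t u = begin
      word i j k ∙ ((A ^ s ∙ B ^ t) ∙ C ^ u)                          ≈⟨ ∙-congʳ (≈-sym (identityʳ _)) ⟩
      nf i j k 0 ∙ ((A ^ s ∙ B ^ t) ∙ C ^ u)                          ≈⟨ MonoidSolver.solve M ⟩
      ((nf i j k 0 ∙ A ^ s) ∙ B ^ t) ∙ C ^ u                          ≈⟨ ∙-congʳ (∙-congʳ (nf∙Aˢ s i j k 0)) ⟩
      (nf (s ℕ.+ i) j k′ l′ ∙ B ^ t) ∙ C ^ u                          ≈⟨ ∙-congʳ (nf∙Bᵗ t (s ℕ.+ i) j k′ l′) ⟩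
      nf (s ℕ.+ i) (t ℕ.+ j) k′ (t ℕ.* k′ ℕ.+ l′) ∙ C ^ u             ≈⟨ nf∙Cᵘ u (s ℕ.+ i) (t ℕ.+ j) k′ (t ℕ.* k′ ℕ.+ l′) ⟩
      nf (s ℕ.+ i) (t ℕ.+ j) (u ℕ.+ k′) (t ℕ.* k′ ℕ.+ l′)             ≈⟨ nf-cong (refl {x = s ℕ.+ i}) (refl {x = t ℕ.+ j}) (refl {x = u ℕ.+ k′}) (exponent s t j k (tri j)) ⟩
      nf (s ℕ.+ i) (t ℕ.+ j) (u ℕ.+ k′) (tri j ℕ.* s ℕ.+ (j ℕ.* s ℕ.+ k) ℕ.* t) ∎
      where
      k′ = s ℕ.* j ℕ.+ k
      l′ = s ℕ.* tri j ℕ.+ 0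
      exponent : ∀ s t j k T → t ℕ.* (s ℕ.* j ℕ.+ k) ℕ.+ (s ℕ.* T ℕ.+ 0) ≡ T ℕ.* s ℕ.+ (j ℕ.* s ℕ.+ k) ℕ.* t
      exponent = ℕ-Solver.solve-∀

    module _ (cancelˡ : ∀ x y z → x ∙ y ≈ x ∙ z → y ≈ z) (n : ℕ) (Cⁿ-central : ∀ x → C ^ n ∙ x ≈ x ∙ C ^ n) where

      Zⁿ≈ε : Z ^ n ≈ ε
      Zⁿ≈ε = ≈-sym (cancelˡ (B ∙ C ^ n) ε (Z ^ n) (begin
        (B ∙ C ^ n) ∙ ε        ≈⟨ identityʳ _ ⟩
        B ∙ C ^ n              ≈⟨ ≈-sym (Cⁿ-central B) ⟩
        C ^ n ∙ B              ≈⟨ Cᵏ∙B n ⟩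
        (B ∙ C ^ n) ∙ Z ^ n    ∎))

      Cⁿ≈ε : B ^ n ≈ ε → ∀ h → tri n ≡ h ℕ.* n → C ^ n ≈ ε
      Cⁿ≈ε Bⁿ≈ε h tri-n≡h*n = begin
        C ^ n                    ≈⟨ ≈-sym (identityʳ _) ⟩
        C ^ n ∙ ε                ≈⟨ ∙-congˡ (≈-sym Z^tri-n≈ε) ⟩
        C ^ n ∙ Z ^ tri n        ≈⟨ ≈-sym (cancelˡ A ε (C ^ n ∙ Z ^ tri n) A∙ε≈A∙Cⁿ∙Zᵗʳⁱⁿ) ⟩
        ε                        ∎
        where
        Z^tri-n≈ε : Z ^ tri n ≈ ε
        Z^tri-n≈ε = ≈-trans (≈-reflexive (cong (Z ^_) tri-n≡h*n)) (^-*≈ε Zⁿ≈ε h)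
        A∙ε≈A∙Cⁿ∙Zᵗʳⁱⁿ : A ∙ ε ≈ A ∙ (C ^ n ∙ Z ^ tri n)
        A∙ε≈A∙Cⁿ∙Zᵗʳⁱⁿ = begin
          A ∙ ε                                  ≈⟨ MonoidSolver.solve M ⟩
          ε ∙ A                                  ≈⟨ ∙-congʳ (≈-sym Bⁿ≈ε) ⟩
          B ^ n ∙ A                              ≈⟨ Bʲ∙A n ⟩
          ((A ∙ B ^ n) ∙ C ^ n) ∙ Z ^ tri n      ≈⟨ ∙-congʳ (∙-congʳ (∙-congˡ Bⁿ≈ε)) ⟩
          ((A ∙ ε) ∙ C ^ n) ∙ Z ^ tri n          ≈⟨ MonoidSolver.solve M ⟩
          A ∙ (C ^ n ∙ Z ^ tri n)                ∎

-- The group G = E_p(p³) and its action on G/H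

module Residues (p : ℕ) ⦃ nz : NonZero p ⦄ where
  open E p
  open Congruence (+ p)
  open import Data.Integer.Base using (_+_; _*_; -_; _-_)

  P : ℤ
  P = + p

  toℕ-red : ∀ z → toℕ (red z) ≡ z %ℕ p
  toℕ-red z = trans (Fin.toℕ-fromℕ< _) (ℕ.m<n⇒m%n≡m (n%ℕd<d z p))

  I-red : ∀ z → I (red z) ≈ z
  I-red z = mk≈ (- (z /ℕ p)) (trans (cong +_ (toℕ-red z)) (shift {q = z /ℕ p} {P} (a≡a%ℕn+[a/ℕn]*n z p)))
    where
    shift : ∀ {z r q Q} → z ≡ r + q * Q → r ≡ z + (- q) * Q
    shift {r = r} {q} {Q} refl = solve (r ∷ q ∷ Q ∷ [])

  private
    no-positive-quotient : ∀ {r₁ r₂} j → r₁ ℕ.< p → + r₁ ≡ + r₂ + + suc j * P → ⊥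
    no-positive-quotient {r₁} {r₂} j r₁<p eq = ℕ.<⇒≱ r₁<p
      (ℕ.≤-trans (ℕ.m≤n*m p (suc j)) (ℕ.≤-trans (ℕ.m≤n+m _ r₂) (ℕ.≤-reflexive (sym r₁≡))))
      where
      r₁≡ : r₁ ≡ r₂ ℕ.+ suc j ℕ.* p
      r₁≡ = ℤ.+-injective (trans eq (trans (cong (_+_ (+ r₂)) (sym (ℤ.pos-* (suc j) p))) (sym (ℤ.pos-+ r₂ _))))

  residue-unique : ∀ {r₁ r₂} → r₁ ℕ.< p → r₂ ℕ.< p → + r₁ ≈ + r₂ → r₁ ≡ r₂
  residue-unique {r₁} {r₂} _ _ (mk≈ (+ zero) eq) =
    ℤ.+-injective (trans eq (trans (cong (_+_ (+ r₂)) (ℤ.*-zeroˡ P)) (ℤ.+-identityʳ (+ r₂))))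
  residue-unique r₁<p _ (mk≈ (+ suc j) eq) = ⊥-elim (no-positive-quotient j r₁<p eq)
  residue-unique {r₁} {r₂} _ r₂<p (mk≈ -[1+ j ] eq) = ⊥-elim (no-positive-quotient j r₂<p (flip {k = + suc j} {P} eq))
    where
    flip : ∀ {a b k Q} → a ≡ b + (- k) * Q → b ≡ a + k * Q
    flip {b = b} {k} {Q} refl = solve (b ∷ k ∷ Q ∷ [])

  red-cong : ∀ {x y} → x ≈ y → red x ≡ red y
  red-cong {x} {y} x≈y = cong (ℕ._mod p) (residue-unique (n%ℕd<d x p) (n%ℕd<d y p) (begin
    + (x %ℕ p)  ≈⟨ ≈-sym (≈-reflexive (cong +_ (toℕ-red x))) ⟩
    I (red x)   ≈⟨ I-red x ⟩
    x           ≈⟨ x≈y ⟩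
    y           ≈⟨ ≈-sym (I-red y) ⟩
    I (red y)   ≈⟨ ≈-reflexive (cong +_ (toℕ-red y)) ⟩
    + (y %ℕ p)  ∎))
    where open SetoidReasoning ≈-setoid

  red-I : ∀ i → red (I i) ≡ i
  red-I i = Fin.toℕ-injective (trans (toℕ-red (I i)) (ℕ.m<n⇒m%n≡m (Fin.toℕ<n i)))

  I-injective : ∀ {i j} → I i ≈ I j → i ≡ j
  I-injective {i} {j} e = trans (sym (red-I i)) (trans (red-cong e) (red-I j))

  I0 : I (red (+ 0)) ≈ + 0
  I0 = I-red (+ 0)

  toℕ-red-+ : ∀ n → n ℕ.< p → toℕ (red (+ n)) ≡ n
  toℕ-red-+ n n<p = trans (toℕ-red (+ n)) (ℕ.m<n⇒m%n≡m n<p)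

  toℕ-red-0 : toℕ (red (+ 0)) ≡ 0
  toℕ-red-0 = toℕ-red-+ 0 (ℕ.>-nonZero⁻¹ p)

  ≈0⇒p∣ : ∀ z → z ≈ + 0 → + p * (z /ℕ p) ≡ z
  ≈0⇒p∣ z z≈0 = sym (trans (a≡a%ℕn+[a/ℕn]*n z p) (trans (cong (λ r → + r + (z /ℕ p) * + p) z%p≡0) (trans (ℤ.+-identityˡ _) (ℤ.*-comm (z /ℕ p) (+ p)))))
    where
    z%p≡0 : z %ℕ p ≡ 0
    z%p≡0 = trans (sym (toℕ-red z)) (trans (cong toℕ (red-cong z≈0)) toℕ-red-0)

module Heisenberg (p : ℕ) ⦃ nz : NonZero p ⦄ where
  open E p
  open Congruence (+ p)
  open import Data.Integer.Base using (_+_; _*_; -_; _-_)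

  open Residues p public

  ℤ³ ℤ² : Set
  ℤ³ = ℤ × ℤ × ℤ
  ℤ² = ℤ × ℤ

  ≈³-setoid : Setoid _ _
  ≈³-setoid = ×-setoid ≈-setoid (×-setoid ≈-setoid ≈-setoid)

  ≈²-setoid : Setoid _ _
  ≈²-setoid = ×-setoid ≈-setoid ≈-setoid

  open Setoid ≈³-setoid public using () renaming
    (_≈_ to _≈³_; refl to ≈³-refl; sym to ≈³-sym; trans to ≈³-trans; reflexive to ≈³-reflexive)
  open Setoid ≈²-setoid public using () renaming
    (_≈_ to _≈²_; refl to ≈²-refl; sym to ≈²-sym; trans to ≈²-trans; reflexive to ≈²-reflexive)

  -- the formulas of Defs for _·_, inv and act, read in ℤ without reduction mod p
  mulℤ³ : ℤ³ → ℤ³ → ℤ³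
  mulℤ³ (s , t , u) (s′ , t′ , u′) = s + s′ , t + t′ , u + u′ + t * s′

  invℤ³ : ℤ³ → ℤ³
  invℤ³ (s , t , u) = - s , - t , t * s - u

  actℤ³ : ℤ³ → ℤ² → ℤ²
  actℤ³ (s , t , u) (τ , ν) = t + τ , ν + u - (t + τ) * s

  oneℤ³ : ℤ³
  oneℤ³ = + 0 , + 0 , + 0

  mulℤ³-cong : ∀ {x x′ y y′} → x ≈³ x′ → y ≈³ y′ → mulℤ³ x y ≈³ mulℤ³ x′ y′
  mulℤ³-cong (e₁ , e₂ , e₃) (f₁ , f₂ , f₃) = +-cong e₁ f₁ , +-cong e₂ f₂ , +-cong (+-cong e₃ f₃) (*-cong e₂ f₁)

  invℤ³-cong : ∀ {x x′} → x ≈³ x′ → invℤ³ x ≈³ invℤ³ x′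
  invℤ³-cong (e₁ , e₂ , e₃) = neg-cong e₁ , neg-cong e₂ , −-cong (*-cong e₂ e₁) e₃

  actℤ³-cong : ∀ {x x′ y y′} → x ≈³ x′ → y ≈² y′ → actℤ³ x y ≈² actℤ³ x′ y′
  actℤ³-cong (e₁ , e₂ , e₃) (f₁ , f₂) = +-cong e₂ f₁ , −-cong (+-cong f₂ e₃) (*-cong (+-cong e₂ f₁) e₁)

  ⌊_⌋ : G → ℤ³
  ⌊ s , t , u ⌋ = I s , I t , I u

  ⌊_⌋ᶜ : Cos → ℤ²
  ⌊ τ , ν ⌋ᶜ = I τ , I ν

  G-ext : ∀ {g h X} → ⌊ g ⌋ ≈³ X → ⌊ h ⌋ ≈³ X → g ≡ h
  G-ext {_ , _ , _} {_ , _ , _} g≈X h≈X with ≈³-trans g≈X (≈³-sym h≈X)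
  ... | e₁ , e₂ , e₃ = cong₂ _,_ (I-injective e₁) (cong₂ _,_ (I-injective e₂) (I-injective e₃))

  Cos-ext : ∀ {x y X} → ⌊ x ⌋ᶜ ≈² X → ⌊ y ⌋ᶜ ≈² X → x ≡ y
  Cos-ext {_ , _} {_ , _} x≈X y≈X with ≈²-trans x≈X (≈²-sym y≈X)
  ... | e₁ , e₂ = cong₂ _,_ (I-injective e₁) (I-injective e₂)

  ⌊·⌋ : ∀ {g h X Y} → ⌊ g ⌋ ≈³ X → ⌊ h ⌋ ≈³ Y → ⌊ g · h ⌋ ≈³ mulℤ³ X Y
  ⌊·⌋ {_ , _ , _} {_ , _ , _} g≈X h≈Y = ≈³-trans (I-red _ , I-red _ , I-red _) (mulℤ³-cong g≈X h≈Y)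

  ⌊inv⌋ : ∀ {g X} → ⌊ g ⌋ ≈³ X → ⌊ inv g ⌋ ≈³ invℤ³ X
  ⌊inv⌋ {_ , _ , _} g≈X = ≈³-trans (I-red _ , I-red _ , I-red _) (invℤ³-cong g≈X)

  ⌊act⌋ : ∀ {g x X Y} → ⌊ g ⌋ ≈³ X → ⌊ x ⌋ᶜ ≈² Y → ⌊ act g x ⌋ᶜ ≈² actℤ³ X Y
  ⌊act⌋ {s , t , u} {τ , ν} g≈X x≈Y = ≈²-trans (I-red _ , coset-coordinate) (actℤ³-cong g≈X x≈Y)
    where
    open SetoidReasoning ≈-setoid
    0̂ = I (red (+ 0))
    coset-coordinate : I (red (I (red (I u + I ν + I t * 0̂)) - I (red (I t + I τ)) * I (red (I s + 0̂))))
                       ≈ I ν + I u - (I t + I τ) * I s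
    coset-coordinate = begin
      I (red (I (red (I u + I ν + I t * 0̂)) - I (red (I t + I τ)) * I (red (I s + 0̂))))
        ≈⟨ I-red _ ⟩
      I (red (I u + I ν + I t * 0̂)) - I (red (I t + I τ)) * I (red (I s + 0̂))
        ≈⟨ −-cong (I-red (I u + I ν + I t * 0̂)) (*-cong (I-red (I t + I τ)) (I-red (I s + 0̂))) ⟩
      I u + I ν + I t * 0̂ - (I t + I τ) * (I s + 0̂)
        ≈⟨ −-cong (+-cong (≈-refl {I u + I ν}) (*-cong (≈-refl {I t}) I0)) (*-cong (≈-refl {I t + I τ}) (+-cong (≈-refl {I s}) I0)) ⟩
      I u + I ν + I t * + 0 - (I t + I τ) * (I s + + 0)
        ≡⟨ rearrange (I u) (I ν) (I t) (I τ) (I s) ⟩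
      I ν + I u - (I t + I τ) * I s ∎
      where
      rearrange : ∀ u ν t τ s → u + ν + t * + 0 - (t + τ) * (s + + 0) ≡ ν + u - (t + τ) * s
      rearrange = solve-∀

  mulℤ³-assoc : ∀ x y z → mulℤ³ (mulℤ³ x y) z ≈³ mulℤ³ x (mulℤ³ y z)
  mulℤ³-assoc (a , b , c) (d , e , f) (g , h , i) =
    ≈-reflexive (ℤ.+-assoc a d g) , ≈-reflexive (ℤ.+-assoc b e h) , ≈-reflexive (central a b c d e f g h i)
    where
    central : ∀ a b c d e f g h i → c + f + b * d + i + (b + e) * g ≡ c + (f + i + e * g) + b * (d + g)
    central = solve-∀

  mulℤ³-identityˡ : ∀ x → mulℤ³ oneℤ³ x ≈³ x
  mulℤ³-identityˡ (a , b , c) = ≈-reflexive (ℤ.+-identityˡ a) , ≈-reflexive (ℤ.+-identityˡ b) , ≈-reflexive (central a c)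
    where
    central : ∀ a c → + 0 + c + + 0 * a ≡ c
    central = solve-∀

  mulℤ³-identityʳ : ∀ x → mulℤ³ x oneℤ³ ≈³ x
  mulℤ³-identityʳ (a , b , c) = ≈-reflexive (ℤ.+-identityʳ a) , ≈-reflexive (ℤ.+-identityʳ b) , ≈-reflexive (central b c)
    where
    central : ∀ b c → c + + 0 + b * + 0 ≡ c
    central = solve-∀

  mulℤ³-inverseˡ : ∀ x → mulℤ³ (invℤ³ x) x ≈³ oneℤ³
  mulℤ³-inverseˡ (a , b , c) = ≈-reflexive (ℤ.+-inverseˡ a) , ≈-reflexive (ℤ.+-inverseˡ b) , ≈-reflexive (central a b c)
    where
    central : ∀ a b c → b * a - c + c + (- b) * a ≡ + 0
    central = solve-∀

  mulℤ³-inverseʳ : ∀ x → mulℤ³ x (invℤ³ x) ≈³ oneℤ³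
  mulℤ³-inverseʳ (a , b , c) = ≈-reflexive (ℤ.+-inverseʳ a) , ≈-reflexive (ℤ.+-inverseʳ b) , ≈-reflexive (central a b c)
    where
    central : ∀ a b c → c + (b * a - c) + b * (- a) ≡ + 0
    central = solve-∀

  actℤ³-∘ : ∀ x y z → actℤ³ x (actℤ³ y z) ≈² actℤ³ (mulℤ³ x y) z
  actℤ³-∘ (a , b , c) (d , e , f) (τ , ν) = ≈-reflexive (sym (ℤ.+-assoc b e τ)) , ≈-reflexive (second a b c d e f τ ν)
    where
    second : ∀ a b c d e f τ ν → ν + f - (e + τ) * d + c - (b + (e + τ)) * a ≡ ν + (c + f + b * d) - (b + e + τ) * (a + d)
    second = solve-∀

  one : G
  one = red (+ 0) , red (+ 0) , red (+ 0)

  ⌊one⌋ : ⌊ one ⌋ ≈³ oneℤ³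
  ⌊one⌋ = I0 , I0 , I0

  ·-assoc : ∀ g h k → (g · h) · k ≡ g · (h · k)
  ·-assoc g h k = G-ext (≈³-trans (⌊·⌋ (⌊·⌋ {g} {h} ≈³-refl ≈³-refl) (≈³-refl {⌊ k ⌋})) (mulℤ³-assoc ⌊ g ⌋ ⌊ h ⌋ ⌊ k ⌋))
                        (⌊·⌋ (≈³-refl {⌊ g ⌋}) (⌊·⌋ {h} {k} ≈³-refl ≈³-refl))

  ·-identityˡ : ∀ g → one · g ≡ g
  ·-identityˡ g = G-ext (≈³-trans (⌊·⌋ {one} {g} ⌊one⌋ ≈³-refl) (mulℤ³-identityˡ ⌊ g ⌋)) ≈³-refl

  ·-identityʳ : ∀ g → g · one ≡ g
  ·-identityʳ g = G-ext (≈³-trans (⌊·⌋ {g} {one} ≈³-refl ⌊one⌋) (mulℤ³-identityʳ ⌊ g ⌋)) ≈³-refl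

  ·-inverseˡ : ∀ g → inv g · g ≡ one
  ·-inverseˡ g = G-ext (≈³-trans (⌊·⌋ (⌊inv⌋ {g} ≈³-refl) ≈³-refl) (mulℤ³-inverseˡ ⌊ g ⌋)) ⌊one⌋

  ·-inverseʳ : ∀ g → g · inv g ≡ one
  ·-inverseʳ g = G-ext (≈³-trans (⌊·⌋ {g} ≈³-refl (⌊inv⌋ {g} ≈³-refl)) (mulℤ³-inverseʳ ⌊ g ⌋)) ⌊one⌋

  G-isGroup : IsGroup _≡_ _·_ one inv
  G-isGroup = record
    { isMonoid = record
      { isSemigroup = record
        { isMagma = record { isEquivalence = isEquivalence ; ∙-cong = cong₂ _·_ }
        ; assoc = ·-assoc }
      ; identity = ·-identityˡ , ·-identityʳ }
    ; inverse = ·-inverseˡ , ·-inverseʳ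
    ; ⁻¹-cong = cong inv }

  G-group : Group _ _
  G-group = record { isGroup = G-isGroup }

  open GroupProperties G-group public using (⁻¹-anti-homo-∙) renaming (∙-cancelˡ to ∙-cancelˡᴳ)
  open MonoidPowers (Group.monoid G-group) public using (_^_; ^-sucʳ)

  act-∘ : ∀ g h x → act g (act h x) ≡ act (g · h) x
  act-∘ g h x = Cos-ext (≈²-trans (⌊act⌋ {g} ≈³-refl (⌊act⌋ {h} {x} ≈³-refl ≈²-refl)) (actℤ³-∘ ⌊ g ⌋ ⌊ h ⌋ ⌊ x ⌋ᶜ))
                        (⌊act⌋ (⌊·⌋ {g} {h} ≈³-refl ≈³-refl) ≈²-refl)

  act-inv-∘ : ∀ g h x → act (inv h) (act (inv g) x) ≡ act (inv (g · h)) x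
  act-inv-∘ g h x = trans (act-∘ (inv h) (inv g) x) (cong (λ k → act k x) (sym (⁻¹-anti-homo-∙ g h)))

  ga gb gc : G
  ga = red (+ 1) , red (+ 0) , red (+ 0)
  gb = red (+ 0) , red (+ 1) , red (+ 0)
  gc = red (+ 0) , red (+ 0) , red (+ 1)

  ⌊ga⌋ : ⌊ ga ⌋ ≈³ (+ 1 , + 0 , + 0)
  ⌊ga⌋ = I-red _ , I-red _ , I-red _

  ⌊gb⌋ : ⌊ gb ⌋ ≈³ (+ 0 , + 1 , + 0)
  ⌊gb⌋ = I-red _ , I-red _ , I-red _

  ⌊gc⌋ : ⌊ gc ⌋ ≈³ (+ 0 , + 0 , + 1)
  ⌊gc⌋ = I-red _ , I-red _ , I-red _

  b·a≡a·b·c : gb · ga ≡ (ga · gb) · gc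
  b·a≡a·b·c = G-ext (⌊·⌋ ⌊gb⌋ ⌊ga⌋) (⌊·⌋ (⌊·⌋ ⌊ga⌋ ⌊gb⌋) ⌊gc⌋)

  c·a≡a·c : gc · ga ≡ ga · gc
  c·a≡a·c = G-ext (⌊·⌋ ⌊gc⌋ ⌊ga⌋) (⌊·⌋ ⌊ga⌋ ⌊gc⌋)

  c·b≡b·c : gc · gb ≡ gb · gc
  c·b≡b·c = G-ext (⌊·⌋ ⌊gc⌋ ⌊gb⌋) (⌊·⌋ ⌊gb⌋ ⌊gc⌋)

  ⌊ga^⌋ : ∀ k → ⌊ ga ^ k ⌋ ≈³ (+ k , + 0 , + 0)
  ⌊ga^⌋ zero    = ⌊one⌋
  ⌊ga^⌋ (suc k) = ⌊·⌋ ⌊ga⌋ (⌊ga^⌋ k)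

  ⌊gb^⌋ : ∀ k → ⌊ gb ^ k ⌋ ≈³ (+ 0 , + k , + 0)
  ⌊gb^⌋ zero    = ⌊one⌋
  ⌊gb^⌋ (suc k) = ⌊·⌋ ⌊gb⌋ (⌊gb^⌋ k)

  ⌊gc^⌋ : ∀ k → ⌊ gc ^ k ⌋ ≈³ (+ 0 , + 0 , + k)
  ⌊gc^⌋ zero    = ⌊one⌋
  ⌊gc^⌋ (suc k) = ≈³-trans (⌊·⌋ ⌊gc⌋ (⌊gc^⌋ k)) (≈-refl , ≈-refl , ≈-reflexive (cong (λ n → + suc n) (ℕ.+-identityʳ k)))

  p≈0 : + p ≈ + 0
  p≈0 = ≈-trans (≈-reflexive (sym (ℤ.*-identityˡ (+ p)))) (multiple≈0 (+ 1))

  ga^p≡one : ga ^ p ≡ one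
  ga^p≡one = G-ext (≈³-trans (⌊ga^⌋ p) (p≈0 , ≈-refl , ≈-refl)) ⌊one⌋

  gb^p≡one : gb ^ p ≡ one
  gb^p≡one = G-ext (≈³-trans (⌊gb^⌋ p) (≈-refl , p≈0 , ≈-refl)) ⌊one⌋

  gc^p≡one : gc ^ p ≡ one
  gc^p≡one = G-ext (≈³-trans (⌊gc^⌋ p) (≈-refl , ≈-refl , p≈0)) ⌊one⌋

  normal-form : ∀ s t u → ((ga ^ toℕ s) · (gb ^ toℕ t)) · (gc ^ toℕ u) ≡ (s , t , u)
  normal-form s t u = G-ext (≈³-trans (⌊·⌋ (⌊·⌋ (⌊ga^⌋ (toℕ s)) (⌊gb^⌋ (toℕ t))) (⌊gc^⌋ (toℕ u)))
                                     (≈-reflexive (first (I s)) , ≈-reflexive (second (I t)) , ≈-reflexive (third (I t) (I u))))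
                            ≈³-refl
    where
    first : ∀ s → s + + 0 + + 0 ≡ s
    first = solve-∀
    second : ∀ t → + 0 + t + + 0 ≡ t
    second = solve-∀
    third : ∀ t u → + 0 + + 0 + + 0 * + 0 + u + (+ 0 + t) * + 0 ≡ u
    third = solve-∀

  ga^≡aPow : ∀ i → ga ^ i ≡ aPow (red (+ i))
  ga^≡aPow i = G-ext (⌊ga^⌋ i) (I-red (+ i) , I0 , I0)

  c·aⁱ≡aⁱ·c : ∀ i → gc · (ga ^ i) ≡ (ga ^ i) · gc
  c·aⁱ≡aⁱ·c i = G-ext (⌊·⌋ ⌊gc⌋ (⌊ga^⌋ i)) (≈³-trans (⌊·⌋ (⌊ga^⌋ i) ⌊gc⌋) (≈-reflexive (ℤ.+-identityʳ (+ i)) , ≈-refl , ≈-refl))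

  H : Cos
  H = red (+ 0) , red (+ 0)

  aⁱ-fixes-H : ∀ i → act (inv (ga ^ i)) H ≡ H
  aⁱ-fixes-H i = Cos-ext (≈²-trans (⌊act⌋ (⌊inv⌋ (⌊ga^⌋ i)) (I0 , I0)) (≈-refl , ≈-reflexive (second (+ i)))) (I0 , I0)
    where
    second : ∀ i → + 0 + (+ 0 * i - + 0) - (- + 0 + + 0) * (- i) ≡ + 0
    second = solve-∀

  f₂-numerator : G → G → ℕ
  f₂-numerator (s₁ , t₁ , u₁) (s₂ , t₂ , u₂) = tri (toℕ t₁) ℕ.* toℕ s₂ ℕ.+ (toℕ t₁ ℕ.* toℕ s₂ ℕ.+ toℕ u₁) ℕ.* toℕ t₂

  f₂≡numerator/p : ∀ g₁ g₂ → f₂ g₁ g₂ ≡ fromℤ (+ f₂-numerator g₁ g₂) ℚ.* (+ 1 / p)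
  f₂≡numerator/p (s₁ , t₁ , u₁) (s₂ , t₂ , u₂) =
    trans (cong (λ n → + (n ℕ.* toℕ s₂ ℕ.+ (toℕ t₁ ℕ.* toℕ s₂ ℕ.+ toℕ u₁) ℕ.* toℕ t₂) / p) (t*[t∸1]/2≡tri (toℕ t₁)))
          (/-as-* (+ f₂-numerator (s₁ , t₁ , u₁) (s₂ , t₂ , u₂)) p)

  aPow-· : ∀ i j → aPow i · aPow j ≡ aPow (red (I i + I j))
  aPow-· i j = G-ext (⌊·⌋ (≈-refl , I0 , I0) (≈-refl , I0 , I0)) (≈³-trans (I-red _ , I0 , I0) (≈-refl , ≈-refl , ≈-reflexive (zeros (I j))))
    where
    zeros : ∀ j → + 0 ≡ + 0 + + 0 + + 0 * j
    zeros = solve-∀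

-- Sums over G/H

open CommutativeMonoidSum ℤ.+-0-commutativeMonoid using (sum; sum-cong-≗; sum-permute)

module _ where
  open import Data.Integer.Base using (_+_; _*_; -_; _-_)

  sum-+ : ∀ {m} (f g : Fin m → ℤ) → sum (λ i → f i + g i) ≡ sum f + sum g
  sum-+ {zero}  f g = refl
  sum-+ {suc m} f g = trans (cong (_+_ (f 0F + g 0F)) (sum-+ (tail f) (tail g))) (interchange (f 0F) (g 0F) _ _)
    where
    interchange : ∀ a b c d → a + b + (c + d) ≡ a + c + (b + d)
    interchange = solve-∀

  sum-neg : ∀ {m} (f : Fin m → ℤ) → sum (λ i → - f i) ≡ - sum f
  sum-neg {zero}  f = refl
  sum-neg {suc m} f = trans (cong (_+_ (- f 0F)) (sum-neg (tail f))) (sym (ℤ.neg-distrib-+ (f 0F) _))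

  sum-const : ∀ m k → sum {m} (λ _ → k) ≡ + m * k
  sum-const zero    k = refl
  sum-const (suc m) k = trans (cong (_+_ k) (sum-const m k)) (sym (ℤ.suc-* (+ m) k))

module CosetSums (p : ℕ) ⦃ nz : NonZero p ⦄ where
  open E p
  open Congruence (+ p)
  open Heisenberg p
  open import Data.Integer.Base using (_+_; _*_; -_; _-_)

  ΣC : M → ℤ
  ΣC f = sum (λ τ → sum (λ ν → f (τ , ν)))

  ΣC-cong : ∀ {f g : M} → (∀ x → f x ≡ g x) → ΣC f ≡ ΣC g
  ΣC-cong f≗g = sum-cong-≗ {p} (λ τ → sum-cong-≗ {p} (λ ν → f≗g (τ , ν)))

  ΣC-+ : ∀ f g → ΣC (λ x → f x + g x) ≡ ΣC f + ΣC g
  ΣC-+ f g = trans (sum-cong-≗ {p} (λ τ → sum-+ (λ ν → f (τ , ν)) (λ ν → g (τ , ν)))) (sum-+ {p} _ _)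

  ΣC-neg : ∀ f → ΣC (λ x → - f x) ≡ - ΣC f
  ΣC-neg f = trans (sum-cong-≗ {p} (λ τ → sum-neg (λ ν → f (τ , ν)))) (sum-neg {p} _)

  ΣC-- : ∀ f g → ΣC (λ x → f x - g x) ≡ ΣC f - ΣC g
  ΣC-- f g = trans (ΣC-+ f (λ x → - g x)) (cong (_+_ (ΣC f)) (ΣC-neg g))

  ΣC-const : ∀ k → ΣC (λ _ → k) ≡ + (p ℕ.* p) * k
  ΣC-const k = begin
    sum {p} (λ _ → sum {p} (λ _ → k)) ≡⟨ sum-cong-≗ {p} (λ _ → sum-const p k) ⟩
    sum {p} (λ _ → + p * k)           ≡⟨ sum-const p (+ p * k) ⟩
    + p * (+ p * k)               ≡⟨ sym (ℤ.*-assoc (+ p) (+ p) k) ⟩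
    + p * + p * k                 ≡⟨ cong (_* k) (sym (ℤ.pos-* p p)) ⟩
    + (p ℕ.* p) * k               ∎
    where open ≡-Reasoning

  translate : ℤ → Fin p → Fin p
  translate c i = red (I i + c)

  translate-inverseˡ : ∀ c i → translate (- c) (translate c i) ≡ i
  translate-inverseˡ c i = trans (red-cong (≈-trans (+-cong (I-red (I i + c)) ≈-refl) (≈-reflexive (cancel (I i) c)))) (red-I i)
    where
    cancel : ∀ a c → a + c + - c ≡ a
    cancel = solve-∀

  translate-inverseʳ : ∀ c i → translate c (translate (- c) i) ≡ i
  translate-inverseʳ c i = trans (red-cong (≈-trans (+-cong (I-red (I i - c)) ≈-refl) (≈-reflexive (cancel (I i) c)))) (red-I i)
    where
    cancel : ∀ a c → a - c + c ≡ a
    cancel = solve-∀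

  sum-translate : ∀ c (f : Fin p → ℤ) → sum (λ i → f (translate c i)) ≡ sum f
  sum-translate c f = sym (sum-permute f (permutation (translate c) (translate (- c)) (translate-inverseʳ c) (translate-inverseˡ c)))

  act-translates : ∀ g → Σ ℤ λ c → Σ (Fin p → ℤ) λ d → ∀ τ ν → act g (τ , ν) ≡ (translate c τ , translate (d τ) ν)
  act-translates (s , t , u) = I t , shiftᵛ , λ τ ν → cong₂ _,_ (cong red (ℤ.+-comm (I t) (I τ))) (red-cong (second τ ν))
    where
    0̂ = I (red (+ 0))
    shiftᵛ : Fin p → ℤ
    shiftᵛ τ = I u + I t * 0̂ - I (translate (I t) τ) * I (red (I s + 0̂))
    rearrange : ∀ u ν t z X → u + ν + t * z - X ≡ ν + (u + t * z - X)
    rearrange = solve-∀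
    second : ∀ τ ν → I (red (I u + I ν + I t * 0̂)) - I (red (I t + I τ)) * I (red (I s + 0̂)) ≈ I ν + shiftᵛ τ
    second τ ν = ≈-trans (+-cong (I-red (I u + I ν + I t * 0̂)) ≈-refl)
                     (≈-reflexive (trans (cong (λ v → I u + I ν + I t * 0̂ - I (red v) * I (red (I s + 0̂))) (ℤ.+-comm (I t) (I τ)))
                                         (rearrange (I u) (I ν) (I t) 0̂ _)))

  ΣC-act : ∀ g f → ΣC (λ x → f (act g x)) ≡ ΣC f
  ΣC-act g f with act-translates g
  ... | c , d , act≡ = begin
    ΣC (λ x → f (act g x))                                     ≡⟨ ΣC-cong (λ (τ , ν) → cong f (act≡ τ ν)) ⟩
    sum (λ τ → sum (λ ν → f (translate c τ , translate (d τ) ν))) ≡⟨ sum-cong-≗ {p} (λ τ → sum-translate (d τ) (λ ν → f (translate c τ , ν))) ⟩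
    sum (λ τ → sum (λ ν → f (translate c τ , ν)))               ≡⟨ sum-translate c (λ τ → sum (λ ν → f (τ , ν))) ⟩
    ΣC f                                                        ∎
    where open ≡-Reasoning

-- Classes with integral ψ(c,a) - ψ(a,c) are multiples of [f₂]

module Classification (p : ℕ) ⦃ nz : NonZero p ⦄ where
  open E p
  open Heisenberg p renaming (_^_ to _^ᴳ_)
  open import Data.Rational.Base using (_+_; _-_; _*_; -_; 0ℚ; 1ℚ)

  module CentralExtension (θ : G → G → ℚ) (θ-cocycle : ∀ g h k → Integral (d2Q θ g h k))
                          (θ-normalised : θ one one ≡ 0ℚ) where

    -- without eta, products of words stay folded, which keeps type checking feasible
    record Ext : Set where
      no-eta-equality
      pattern
      constructor _,,_
      field
        coord : ℚ
        base  : G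
    open Ext
    infixr 4 _,,_

    infixl 7 _∙_
    _∙_ : Ext → Ext → Ext
    (q ,, g) ∙ (r ,, h) = q + r + θ g h ,, g · h

    e : Ext
    e = 0ℚ ,, one

    infix 4 _≈_
    record _≈_ (x y : Ext) : Set where
      constructor mk≈
      field
        base≡    : base x ≡ base y
        integral : Integral (coord x - coord y)

    ≈-refl : ∀ {x} → x ≈ x
    ≈-refl {q ,, g} = mk≈ refl (subst Integral (sym (q-q≡0 q)) integral-0)
      where
      q-q≡0 : ∀ q → q - q ≡ 0ℚ
      q-q≡0 = RingSolver.solve-∀ ℚ-ring

    ≈-sym : ∀ {x y} → x ≈ y → y ≈ x
    ≈-sym {q ,, g} {r ,, _} (mk≈ refl i) = mk≈ refl (subst Integral (negate q r) (integral-neg i))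
      where
      negate : ∀ q r → - (q - r) ≡ r - q
      negate = RingSolver.solve-∀ ℚ-ring

    ≈-trans : ∀ {x y z} → x ≈ y → y ≈ z → x ≈ z
    ≈-trans {q ,, g} {r ,, _} {s ,, _} (mk≈ refl i) (mk≈ refl j) = mk≈ refl (subst Integral (telescope q r s) (integral-+ i j))
      where
      telescope : ∀ q r s → (q - r) + (r - s) ≡ q - s
      telescope = RingSolver.solve-∀ ℚ-ring

    ≈-reflexive : ∀ {x y} → x ≡ y → x ≈ y
    ≈-reflexive refl = ≈-refl

    ∙-cong : ∀ {x x′ y y′} → x ≈ x′ → y ≈ y′ → x ∙ y ≈ x′ ∙ y′
    ∙-cong {q ,, g} {q′ ,, _} {r ,, h} {r′ ,, _} (mk≈ refl i) (mk≈ refl j) =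
      mk≈ refl (subst Integral (rearrange q q′ r r′ (θ g h)) (integral-+ i j))
      where
      rearrange : ∀ q q′ r r′ t → (q - q′) + (r - r′) ≡ (q + r + t) - (q′ + r′ + t)
      rearrange = RingSolver.solve-∀ ℚ-ring

    ∙-assoc : ∀ x y z → (x ∙ y) ∙ z ≈ x ∙ (y ∙ z)
    ∙-assoc (q ,, g) (r ,, h) (s ,, k) =
      mk≈ (·-assoc g h k) (subst Integral (rearrange q r s (θ g h) (θ (g · h) k) (θ h k) (θ g (h · k))) (integral-neg (θ-cocycle g h k)))
      where
      rearrange : ∀ q r s a b c d → - (c - b + d - a) ≡ (q + r + a) + s + b - (q + (r + s + c) + d)
      rearrange = RingSolver.solve-∀ ℚ-ring

    θ[one,g]-integral : ∀ g → Integral (θ one g)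
    θ[one,g]-integral g = subst Integral d2Q≡θ[one,g] (θ-cocycle one one g)
      where
      open ≡-Reasoning
      rearrange : ∀ a → a - a + a - 0ℚ ≡ a
      rearrange = RingSolver.solve-∀ ℚ-ring
      d2Q≡θ[one,g] : d2Q θ one one g ≡ θ one g
      d2Q≡θ[one,g] = begin
        θ one g - θ (one · one) g + θ one (one · g) - θ one one
          ≡⟨ cong₂ (λ u v → θ one g - θ u g + θ one v - θ one one) (·-identityˡ one) (·-identityˡ g) ⟩
        θ one g - θ one g + θ one g - θ one one
          ≡⟨ cong (_-_ (θ one g - θ one g + θ one g)) θ-normalised ⟩
        θ one g - θ one g + θ one g - 0ℚ
          ≡⟨ rearrange (θ one g) ⟩
        θ one g ∎

    θ[g,one]-integral : ∀ g → Integral (θ g one)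
    θ[g,one]-integral g = subst Integral -d2Q≡θ[g,one] (integral-neg (θ-cocycle g one one))
      where
      open ≡-Reasoning
      rearrange : ∀ a → - (0ℚ - a + a - a) ≡ a
      rearrange = RingSolver.solve-∀ ℚ-ring
      -d2Q≡θ[g,one] : - d2Q θ g one one ≡ θ g one
      -d2Q≡θ[g,one] = begin
        - (θ one one - θ (g · one) one + θ g (one · one) - θ g one)
          ≡⟨ cong₂ (λ u v → - (θ one one - θ u one + θ g v - θ g one)) (·-identityʳ g) (·-identityˡ one) ⟩
        - (θ one one - θ g one + θ g one - θ g one)
          ≡⟨ cong (λ v → - (v - θ g one + θ g one - θ g one)) θ-normalised ⟩
        - (0ℚ - θ g one + θ g one - θ g one)
          ≡⟨ rearrange (θ g one) ⟩
        θ g one ∎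

    ∙-identityˡ : ∀ x → e ∙ x ≈ x
    ∙-identityˡ (q ,, g) = mk≈ (·-identityˡ g) (subst Integral (rearrange q (θ one g)) (θ[one,g]-integral g))
      where
      rearrange : ∀ q t → t ≡ 0ℚ + q + t - q
      rearrange = RingSolver.solve-∀ ℚ-ring

    ∙-identityʳ : ∀ x → x ∙ e ≈ x
    ∙-identityʳ (q ,, g) = mk≈ (·-identityʳ g) (subst Integral (rearrange q (θ g one)) (θ[g,one]-integral g))
      where
      rearrange : ∀ q t → t ≡ q + 0ℚ + t - q
      rearrange = RingSolver.solve-∀ ℚ-ring

    Ext-monoid : Monoid _ _
    Ext-monoid = record
      { Carrier = Ext ; _≈_ = _≈_ ; _∙_ = _∙_ ; ε = e
      ; isMonoid = record
        { isSemigroup = record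
          { isMagma = record
            { isEquivalence = record { refl = ≈-refl ; sym = ≈-sym ; trans = ≈-trans }
            ; ∙-cong = ∙-cong }
          ; assoc = ∙-assoc }
        ; identity = ∙-identityˡ , ∙-identityʳ } }

    ∙-cancelˡ : ∀ x y z → x ∙ y ≈ x ∙ z → y ≈ z
    ∙-cancelˡ (q ,, g) (r ,, h) (s ,, k) (mk≈ gh≡gk i) with ∙-cancelˡᴳ g h k gh≡gk
    ... | refl = mk≈ refl (subst Integral (rearrange q r s (θ g h)) i)
      where
      rearrange : ∀ q r s t → (q + r + t) - (q + s + t) ≡ r - s
      rearrange = RingSolver.solve-∀ ℚ-ring

    over-one-central : ∀ q x → (q ,, one) ∙ x ≈ x ∙ (q ,, one)
    over-one-central q (r ,, g) = mk≈ (trans (·-identityˡ g) (sym (·-identityʳ g)))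
      (subst Integral (rearrange q r (θ one g) (θ g one)) (integral-- (θ[one,g]-integral g) (θ[g,one]-integral g)))
      where
      rearrange : ∀ q r a b → a - b ≡ (q + r + a) - (r + q + b)
      rearrange = RingSolver.solve-∀ ℚ-ring

    open MonoidPowers Ext-monoid using (_^_; ^-%)

    base-∙ : ∀ x y → base (x ∙ y) ≡ base x · base y
    base-∙ (q ,, g) (r ,, h) = refl

    coord-∙ : ∀ x y → coord (x ∙ y) ≡ coord x + coord y + θ (base x) (base y)
    coord-∙ (q ,, g) (r ,, h) = refl

    Σθ : G → ℕ → ℚ
    Σθ g zero    = 0ℚ
    Σθ g (suc k) = θ g (g ^ᴳ k) + Σθ g k

    ^-coordinates : ∀ α g k → (α ,, g) ^ k ≡ (fromℤ (+ k) * α + Σθ g k ,, g ^ᴳ k)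
    ^-coordinates α g zero    = cong (_,, one) (rearrange α)
      where
      rearrange : ∀ α → 0ℚ ≡ 0ℚ * α + 0ℚ
      rearrange = RingSolver.solve-∀ ℚ-ring
    ^-coordinates α g (suc k) rewrite ^-coordinates α g k =
      cong (_,, g · (g ^ᴳ k)) (trans (rearrange α (fromℤ (+ k)) (Σθ g k) (θ g (g ^ᴳ k)))
                                   (cong (λ n → n * α + (θ g (g ^ᴳ k) + Σθ g k)) (sym (fromℤ-+ (+ 1) (+ k)))))
      where
      rearrange : ∀ α k s t → α + (k * α + s) + t ≡ (1ℚ + k) * α + (t + s)
      rearrange = RingSolver.solve-∀ ℚ-ring

    -- subtracting the average Σθ g p / p of the coordinate makes the p-th power trivial
    lift : G → Ext
    lift g = - (Σθ g p * (+ 1 / p)) ,, g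

    lift^p≈e : ∀ g → g ^ᴳ p ≡ one → lift g ^ p ≈ e
    lift^p≈e g gᵖ≡one rewrite ^-coordinates (- (Σθ g p * (+ 1 / p))) g p =
      mk≈ gᵖ≡one (subst Integral (sym coordinate≡0) integral-0)
      where
      rearrange : ∀ P S w → P * (- (S * w)) + S - 0ℚ ≡ S * (1ℚ - w * P)
      rearrange = RingSolver.solve-∀ ℚ-ring
      cancel : ∀ S → S * (1ℚ - 1ℚ) ≡ 0ℚ
      cancel = RingSolver.solve-∀ ℚ-ring
      coordinate≡0 : fromℤ (+ p) * (- (Σθ g p * (+ 1 / p))) + Σθ g p - 0ℚ ≡ 0ℚ
      coordinate≡0 = trans (rearrange (fromℤ (+ p)) (Σθ g p) (+ 1 / p))
                           (trans (cong (λ v → Σθ g p * (1ℚ - v)) (1/d*d≡1 p)) (cancel (Σθ g p)))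

    module Lifts (θ[c,a]-θ[a,c]-integral : Integral (θ gc ga - θ ga gc)) (h : ℕ) (tri-p≡h*p : tri p ≡ h ℕ.* p) where

      A B C Z : Ext
      A = lift ga
      B = lift gb
      C = θ gb ga - θ ga gb - θ (ga · gb) gc ,, gc
      ζ : ℚ
      ζ = θ gc gb - θ gb gc - θ (gb · gc) one
      Z = ζ ,, one

      B∙A≈A∙B∙C : B ∙ A ≈ (A ∙ B) ∙ C
      B∙A≈A∙B∙C = mk≈ b·a≡a·b·c (subst Integral (sym (rearrange (coord B) (coord A) (θ gb ga) (θ ga gb) (θ (ga · gb) gc))) integral-0)
        where
        rearrange : ∀ b a x y z → b + a + x - ((a + b + y) + (x - y - z) + z) ≡ 0ℚ
        rearrange = RingSolver.solve-∀ ℚ-ring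

      C∙A≈A∙C : C ∙ A ≈ A ∙ C
      C∙A≈A∙C = mk≈ c·a≡a·c (subst Integral (rearrange (coord C) (coord A) (θ gc ga) (θ ga gc)) θ[c,a]-θ[a,c]-integral)
        where
        rearrange : ∀ c a x y → x - y ≡ (c + a + x) - (a + c + y)
        rearrange = RingSolver.solve-∀ ℚ-ring

      C∙B≈B∙C∙Z : C ∙ B ≈ (B ∙ C) ∙ Z
      C∙B≈B∙C∙Z = mk≈ (trans c·b≡b·c (sym (·-identityʳ (gb · gc))))
        (subst Integral (sym (rearrange (coord C) (coord B) (θ gc gb) (θ gb gc) (θ (gb · gc) one))) integral-0)
        where
        rearrange : ∀ c b x y z → c + b + x - ((b + c + y) + (x - y - z) + z) ≡ 0ℚ
        rearrange = RingSolver.solve-∀ ℚ-ring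

      Cᵖ-central : ∀ x → C ^ p ∙ x ≈ x ∙ C ^ p
      Cᵖ-central x = begin
        C ^ p ∙ x          ≈⟨ ∙-cong Cᵖ≈over-one ≈-refl ⟩
        (_ ,, one) ∙ x     ≈⟨ over-one-central _ x ⟩
        x ∙ (_ ,, one)     ≈⟨ ∙-cong ≈-refl (≈-sym Cᵖ≈over-one) ⟩
        x ∙ C ^ p          ∎
        where
        open SetoidReasoning (Monoid.setoid Ext-monoid)
        Cᵖ≈over-one : C ^ p ≈ (coord (C ^ p) ,, one)
        Cᵖ≈over-one rewrite ^-coordinates (coord C) gc p = ≈-reflexive (cong (fromℤ (+ p) * coord C + Σθ gc p ,,_) gc^p≡one)

      open HeisenbergCollection Ext-monoid
      open Relations A B C Z B∙A≈A∙B∙C C∙A≈A∙C C∙B≈B∙C∙Z (over-one-central ζ)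

      Zᵖ≈e : Z ^ p ≈ e
      Zᵖ≈e = Zⁿ≈ε ∙-cancelˡ p Cᵖ-central

      Aᵖ≈e : A ^ p ≈ e
      Aᵖ≈e = lift^p≈e ga ga^p≡one

      Bᵖ≈e : B ^ p ≈ e
      Bᵖ≈e = lift^p≈e gb gb^p≡one

      Cᵖ≈e : C ^ p ≈ e
      Cᵖ≈e = Cⁿ≈ε ∙-cancelˡ p Cᵖ-central Bᵖ≈e h tri-p≡h*p

      Z^-coordinates : ∀ k → Z ^ k ≈ (fromℤ (+ k) * ζ ,, one)
      Z^-coordinates zero    = mk≈ refl (subst Integral (sym (rearrange ζ)) integral-0)
        where
        rearrange : ∀ z → 0ℚ - 0ℚ * z ≡ 0ℚ
        rearrange = RingSolver.solve-∀ ℚ-ring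
      Z^-coordinates (suc k) = ≈-trans (∙-cong (≈-refl {Z}) (Z^-coordinates k))
        (mk≈ (·-identityˡ one) (subst Integral (sym coordinate≡0) integral-0))
        where
        rearrange : ∀ k z t → z + k * z + t - (1ℚ + k) * z ≡ t
        rearrange = RingSolver.solve-∀ ℚ-ring
        coordinate≡0 : ζ + fromℤ (+ k) * ζ + θ one one - fromℤ (+ suc k) * ζ ≡ 0ℚ
        coordinate≡0 = trans (cong (λ n → ζ + fromℤ (+ k) * ζ + θ one one - n * ζ) (fromℤ-+ (+ 1) (+ k)))
                             (trans (rearrange (fromℤ (+ k)) ζ (θ one one)) θ-normalised)

      ζ≡k/p+integer : ∃ λ (k : ℕ) → Integral (ζ - fromℤ (+ k) * (+ 1 / p))
      ζ≡k/p+integer = multiple-integral⇒≡k/d p (subst Integral (rearrange (fromℤ (+ p) * ζ)) (_≈_.integral pζ≈0))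
        where
        pζ≈0 : (fromℤ (+ p) * ζ ,, one) ≈ e
        pζ≈0 = ≈-trans (≈-sym (Z^-coordinates p)) Zᵖ≈e
        rearrange : ∀ x → x - 0ℚ ≡ x
        rearrange = RingSolver.solve-∀ ℚ-ring

      σ : G → Ext
      σ (s , t , u) = word (toℕ s) (toℕ t) (toℕ u)

      base-^ : ∀ x k → base (x ^ k) ≡ base x ^ᴳ k
      base-^ (α ,, g) k = cong base (^-coordinates α g k)

      base-σ : ∀ g → base (σ g) ≡ g
      base-σ (s , t , u) = begin
        base (σ (s , t , u))                                           ≡⟨ base-∙ (A ^ toℕ s ∙ B ^ toℕ t) (C ^ toℕ u) ⟩
        base (A ^ toℕ s ∙ B ^ toℕ t) · base (C ^ toℕ u)               ≡⟨ cong (_· base (C ^ toℕ u)) (base-∙ (A ^ toℕ s) (B ^ toℕ t)) ⟩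
        (base (A ^ toℕ s) · base (B ^ toℕ t)) · base (C ^ toℕ u)      ≡⟨ cong₂ _·_ (cong₂ _·_ (base-^ A (toℕ s)) (base-^ B (toℕ t))) (base-^ C (toℕ u)) ⟩
        ((ga ^ᴳ toℕ s) · (gb ^ᴳ toℕ t)) · (gc ^ᴳ toℕ u)               ≡⟨ normal-form s t u ⟩
        (s , t , u)                                                    ∎
        where open ≡-Reasoning

      word-mod-p : ∀ i j k → word i j k ≈ word (i ℕ.% p) (j ℕ.% p) (k ℕ.% p)
      word-mod-p i j k = ∙-cong (∙-cong (^-% Aᵖ≈e i) (^-% Bᵖ≈e j)) (^-% Cᵖ≈e k)

      σ-∙ : ∀ g₁ g₂ → σ g₁ ∙ σ g₂ ≈ σ (g₁ · g₂) ∙ Z ^ f₂-numerator g₁ g₂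
      σ-∙ (s₁ , t₁ , u₁) (s₂ , t₂ , u₂) =
        ≈-trans (word-∙ S₁ T₁ U₁ S₂ T₂ U₂) (∙-cong (≈-trans (word-mod-p _ _ _) (≈-reflexive σ[g₁·g₂])) ≈-refl)
        where
        S₁ = toℕ s₁ ; T₁ = toℕ t₁ ; U₁ = toℕ u₁ ; S₂ = toℕ s₂ ; T₂ = toℕ t₂ ; U₂ = toℕ u₂
        rearrange : ∀ a b c d → a ℕ.+ b ℕ.+ c ℕ.* d ≡ b ℕ.+ (d ℕ.* c ℕ.+ a)
        rearrange = ℕ-Solver.solve-∀
        σ[g₁·g₂] : word ((S₂ ℕ.+ S₁) ℕ.% p) ((T₂ ℕ.+ T₁) ℕ.% p) ((U₂ ℕ.+ (S₂ ℕ.* T₁ ℕ.+ U₁)) ℕ.% p)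
                   ≡ σ ((s₁ , t₁ , u₁) · (s₂ , t₂ , u₂))
        σ[g₁·g₂] = sym (cong₃ word
          (trans (toℕ-red (I s₁ ℤ.+ I s₂)) (cong (ℕ._% p) (ℕ.+-comm S₁ S₂)))
          (trans (toℕ-red (I t₁ ℤ.+ I t₂)) (cong (ℕ._% p) (ℕ.+-comm T₁ T₂)))
          (trans (toℕ-red (I u₁ ℤ.+ I u₂ ℤ.+ I t₁ ℤ.* I s₂))
                 (cong (ℤ._%ℕ p) (trans (cong (ℤ._+_ (I u₁ ℤ.+ I u₂)) (sym (ℤ.pos-* T₁ S₂))) (cong +_ (rearrange U₁ U₂ T₁ S₂))))))
          where
          cong₃ : ∀ f {a b c a′ b′ c′} → a ≡ a′ → b ≡ b′ → c ≡ c′ → f a b c ≡ f a′ b′ c′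
          cong₃ f refl refl refl = refl

      coord-σ∙ : ∀ g x → coord (σ g ∙ x) ≡ coord (σ g) + coord x + θ g (base x)
      coord-σ∙ g x = trans (coord-∙ (σ g) x) (cong (λ b → coord (σ g) + coord x + θ b (base x)) (base-σ g))

      σ-coordinates : ∀ g₁ g₂ → Integral (coord (σ g₁) + coord (σ g₂) + θ g₁ g₂
                                           - (coord (σ (g₁ · g₂)) + fromℤ (+ f₂-numerator g₁ g₂) * ζ))
      σ-coordinates g₁ g₂ = subst Integral coordinates (integral-+ (_≈_.integral σ-∙′) (θ[g,one]-integral (g₁ · g₂)))
        where
        N = fromℤ (+ f₂-numerator g₁ g₂)
        σ-∙′ : σ g₁ ∙ σ g₂ ≈ σ (g₁ · g₂) ∙ (N * ζ ,, one)
        σ-∙′ = ≈-trans (σ-∙ g₁ g₂) (∙-cong ≈-refl (Z^-coordinates (f₂-numerator g₁ g₂)))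
        rearrange : ∀ a b t c n u → (a + b + t - (c + n + u)) + u ≡ a + b + t - (c + n)
        rearrange = RingSolver.solve-∀ ℚ-ring
        coordinates : coord (σ g₁ ∙ σ g₂) - coord (σ (g₁ · g₂) ∙ (N * ζ ,, one)) + θ (g₁ · g₂) one
                      ≡ coord (σ g₁) + coord (σ g₂) + θ g₁ g₂ - (coord (σ (g₁ · g₂)) + N * ζ)
        coordinates = trans (cong₂ (λ u v → u - v + θ (g₁ · g₂) one) (coord-σ∙ g₁ (σ g₂)) (coord-σ∙ (g₁ · g₂) (N * ζ ,, one)))
          (trans (cong (λ b → coord (σ g₁) + coord (σ g₂) + θ g₁ b - (coord (σ (g₁ · g₂)) + N * ζ + θ (g₁ · g₂) one) + θ (g₁ · g₂) one) (base-σ g₂))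
                 (rearrange (coord (σ g₁)) (coord (σ g₂)) (θ g₁ g₂) (coord (σ (g₁ · g₂))) (N * ζ) (θ (g₁ · g₂) one)))

      classify : ∃ λ (k : ℕ) → SameClassQZ θ (scale k f₂)
      classify = k , (λ g → - coord (σ g)) , λ g₁ g₂ →
        subst Integral (coboundary g₁ g₂) (integral-+ (σ-coordinates g₁ g₂) (integral-*ℤ (+ f₂-numerator g₁ g₂) ζ-k/p-integral))
        where
        k = proj₁ ζ≡k/p+integer
        ζ-k/p-integral = proj₂ ζ≡k/p+integer
        rearrange : ∀ a b t c N z K w → a + b + t - (c + N * z) + N * (z - K * w) ≡ t - K * (N * w) - (- b - - c + - a)
        rearrange = RingSolver.solve-∀ ℚ-ring
        coboundary : ∀ g₁ g₂ → coord (σ g₁) + coord (σ g₂) + θ g₁ g₂ - (coord (σ (g₁ · g₂)) + fromℤ (+ f₂-numerator g₁ g₂) * ζ)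
                               + fromℤ (+ f₂-numerator g₁ g₂) * (ζ - fromℤ (+ k) * (+ 1 / p))
                             ≡ θ g₁ g₂ - scale k f₂ g₁ g₂ - d1Q (λ g → - coord (σ g)) g₁ g₂
        coboundary g₁ g₂ = trans
          (rearrange (coord (σ g₁)) (coord (σ g₂)) (θ g₁ g₂) (coord (σ (g₁ · g₂))) (fromℤ (+ f₂-numerator g₁ g₂)) ζ (fromℤ (+ k)) (+ 1 / p))
          (cong (λ f → θ g₁ g₂ - fromℤ (+ k) * f - d1Q (λ g → - coord (σ g)) g₁ g₂) (sym (f₂≡numerator/p g₁ g₂)))

  -- a constant shift normalises θ one one = 0 without changing d2Q θ, θ(c,a) - θ(a,c) or the class mod Z
  classify : ∀ (h : ℕ) → tri p ≡ h ℕ.* p → (θ : G → G → ℚ) → (∀ g₁ g₂ g₃ → Integral (d2Q θ g₁ g₂ g₃)) →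
             Integral (θ gc ga - θ ga gc) → ∃ λ (k : ℕ) → SameClassQZ θ (scale k f₂)
  classify h tri-p≡h*p θ θ-cocycle θ[c,a]-θ[a,c]-integral = k , (λ g → η g + c₀) , λ g₁ g₂ →
    subst Integral (unshift c₀ (θ g₁ g₂) (scale k f₂ g₁ g₂) (η g₂) (η (g₁ · g₂)) (η g₁)) (η-bounds g₁ g₂)
    where
    c₀ = θ one one
    θ′ : G → G → ℚ
    θ′ g₁ g₂ = θ g₁ g₂ - c₀
    shift-d2Q : ∀ c₀ a b c d → a - b + c - d ≡ (a - c₀) - (b - c₀) + (c - c₀) - (d - c₀)
    shift-d2Q = RingSolver.solve-∀ ℚ-ring
    shift-pair : ∀ c₀ a b → a - b ≡ (a - c₀) - (b - c₀)
    shift-pair = RingSolver.solve-∀ ℚ-ring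
    unshift : ∀ c₀ t f a b d → (t - c₀) - f - (a - b + d) ≡ t - f - ((a + c₀) - (b + c₀) + (d + c₀))
    unshift = RingSolver.solve-∀ ℚ-ring
    cancel : ∀ a → a - a ≡ 0ℚ
    cancel = RingSolver.solve-∀ ℚ-ring
    normalised-classify : ∃ λ (k : ℕ) → SameClassQZ θ′ (scale k f₂)
    normalised-classify = CentralExtension.Lifts.classify θ′
      (λ g₁ g₂ g₃ → subst Integral (shift-d2Q c₀ (θ g₂ g₃) (θ (g₁ · g₂) g₃) (θ g₁ (g₂ · g₃)) (θ g₁ g₂)) (θ-cocycle g₁ g₂ g₃))
      (cancel c₀)
      (subst Integral (shift-pair c₀ (θ gc ga) (θ ga gc)) θ[c,a]-θ[a,c]-integral) h tri-p≡h*p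
    k = proj₁ normalised-classify
    η = proj₁ (proj₂ normalised-classify)
    η-bounds = proj₂ (proj₂ normalised-classify)

-- The kernel of the restriction

module _ where
  open import Data.Integer.Base using (_+_; _*_; -_; _-_)

  sum< : ℕ → (ℕ → ℤ) → ℤ
  sum< zero    f = + 0
  sum< (suc n) f = sum< n f + f n

  sum<-cong : ∀ n {f g : ℕ → ℤ} → (∀ i → f i ≡ g i) → sum< n f ≡ sum< n g
  sum<-cong zero    f≗g = refl
  sum<-cong (suc n) f≗g = cong₂ _+_ (sum<-cong n f≗g) (f≗g n)

  sum<-const : ∀ n c → sum< n (λ _ → c) ≡ + n * c
  sum<-const zero    c = sym (ℤ.*-zeroˡ c)
  sum<-const (suc n) c = trans (cong (_+ c) (sum<-const n c)) (trans (ℤ.+-comm (+ n * c) c) (sym (ℤ.suc-* (+ n) c)))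

  sum<-telescope : ∀ n (T K : ℕ → ℤ) → sum< n (λ i → T (suc i) - T i - K i) ≡ T n - T 0 - sum< n K
  sum<-telescope zero    T K = rearrange (T 0)
    where
    rearrange : ∀ a → + 0 ≡ a - a - + 0
    rearrange = solve-∀
  sum<-telescope (suc n) T K = trans (cong (_+ (T (suc n) - T n - K n)) (sum<-telescope n T K)) (rearrange (T n) (T 0) (sum< n K) (T (suc n)) (K n))
    where
    rearrange : ∀ a b c d e → a - b - c + (d - a - e) ≡ d - b - (c + e)
    rearrange = solve-∀

module RestrictionKernel (p : ℕ) ⦃ nz : NonZero p ⦄ where
  open E p
  open Heisenberg p
  open CosetSums p
  open import Data.Integer.Base using (_+_; _*_; -_; _-_)

  ΣC-sum< : ∀ n (f : ℕ → M) → ΣC (λ x → sum< n (λ i → f i x)) ≡ sum< n (λ i → ΣC (f i))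
  ΣC-sum< zero    f = trans (ΣC-const (+ 0)) (ℤ.*-zeroʳ (+ (p ℕ.* p)))
  ΣC-sum< (suc n) f = trans (ΣC-+ (λ x → sum< n (λ i → f i x)) (f n)) (cong (_+ ΣC (f n)) (ΣC-sum< n f))

  ΣC-d2M : ∀ F g₁ g₂ g₃ → ΣC (d2M F g₁ g₂ g₃) ≡ ΣC (F g₂ g₃) - ΣC (F (g₁ · g₂) g₃) + ΣC (F g₁ (g₂ · g₃)) - ΣC (F g₁ g₂)
  ΣC-d2M F g₁ g₂ g₃ = begin
    ΣC (d2M F g₁ g₂ g₃)
      ≡⟨ ΣC-- (λ x → (g₁ ▷ F g₂ g₃) x - F (g₁ · g₂) g₃ x + F g₁ (g₂ · g₃) x) (F g₁ g₂) ⟩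
    ΣC (λ x → (g₁ ▷ F g₂ g₃) x - F (g₁ · g₂) g₃ x + F g₁ (g₂ · g₃) x) - ΣC (F g₁ g₂)
      ≡⟨ cong (_- ΣC (F g₁ g₂)) (ΣC-+ (λ x → (g₁ ▷ F g₂ g₃) x - F (g₁ · g₂) g₃ x) (F g₁ (g₂ · g₃))) ⟩
    ΣC (λ x → (g₁ ▷ F g₂ g₃) x - F (g₁ · g₂) g₃ x) + ΣC (F g₁ (g₂ · g₃)) - ΣC (F g₁ g₂)
      ≡⟨ cong (λ s → s + ΣC (F g₁ (g₂ · g₃)) - ΣC (F g₁ g₂)) (ΣC-- (g₁ ▷ F g₂ g₃) (F (g₁ · g₂) g₃)) ⟩
    ΣC (g₁ ▷ F g₂ g₃) - ΣC (F (g₁ · g₂) g₃) + ΣC (F g₁ (g₂ · g₃)) - ΣC (F g₁ g₂)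
      ≡⟨ cong (λ s → s - ΣC (F (g₁ · g₂) g₃) + ΣC (F g₁ (g₂ · g₃)) - ΣC (F g₁ g₂)) (ΣC-act (inv g₁) (F g₂ g₃)) ⟩
    ΣC (F g₂ g₃) - ΣC (F (g₁ · g₂) g₃) + ΣC (F g₁ (g₂ · g₃)) - ΣC (F g₁ g₂) ∎
    where open ≡-Reasoning

  instance
    p*p≢0 : NonZero (p ℕ.* p)
    p*p≢0 = ℕ.m*n≢0 p p

  average : M → ℚ
  average f = fromℤ (ΣC f) ℚ.* (+ 1 / (p ℕ.* p))

  average-const : ∀ {f : M} k → (∀ x → f x ≡ k) → average f ≡ fromℤ k
  average-const {f} k f≡k = trans (cong (λ s → fromℤ s ℚ.* (+ 1 / (p ℕ.* p))) (trans (ΣC-cong f≡k) (ΣC-const k)))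
                                  (n*k/n≡k (p ℕ.* p) k)

  average-d2M : ∀ F g₁ g₂ g₃ → average (d2M F g₁ g₂ g₃) ≡ d2Q (λ g h → average (F g h)) g₁ g₂ g₃
  average-d2M F g₁ g₂ g₃ = begin
    fromℤ (ΣC (d2M F g₁ g₂ g₃)) ℚ.* w                     ≡⟨ cong (λ s → fromℤ s ℚ.* w) (ΣC-d2M F g₁ g₂ g₃) ⟩
    fromℤ (a - b + c - d) ℚ.* w                            ≡⟨ cong (ℚ._* w) (fromℤ-alternating a b c d) ⟩
    (fromℤ a ℚ.- fromℤ b ℚ.+ fromℤ c ℚ.- fromℤ d) ℚ.* w   ≡⟨ distribute (fromℤ a) (fromℤ b) (fromℤ c) (fromℤ d) w ⟩
    fromℤ a ℚ.* w ℚ.- fromℤ b ℚ.* w ℚ.+ fromℤ c ℚ.* w ℚ.- fromℤ d ℚ.* w ∎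
    where
    open ≡-Reasoning
    w = + 1 / (p ℕ.* p)
    a = ΣC (F g₂ g₃)
    b = ΣC (F (g₁ · g₂) g₃)
    c = ΣC (F g₁ (g₂ · g₃))
    d = ΣC (F g₁ g₂)
    distribute : ∀ a b c d w → (a ℚ.- b ℚ.+ c ℚ.- d) ℚ.* w ≡ a ℚ.* w ℚ.- b ℚ.* w ℚ.+ c ℚ.* w ℚ.- d ℚ.* w
    distribute = RingSolver.solve-∀ ℚ-ring

  module _ (F : G → G → M) (F-cocycle : JCocycle F) where

    ψ : G → G → ℚ
    ψ g₁ g₂ = average (F g₁ g₂)

    δF≡∂ψ : ∀ g₁ g₂ g₃ x → d2M F g₁ g₂ g₃ x ℚ./ 1 ≡ d2Q ψ g₁ g₂ g₃
    δF≡∂ψ g₁ g₂ g₃ x = begin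
      fromℤ (d2M F g₁ g₂ g₃ x)       ≡⟨ cong fromℤ (proj₂ (F-cocycle g₁ g₂ g₃) x) ⟩
      fromℤ (proj₁ (F-cocycle g₁ g₂ g₃)) ≡⟨ sym (average-const _ (proj₂ (F-cocycle g₁ g₂ g₃))) ⟩
      average (d2M F g₁ g₂ g₃)       ≡⟨ average-d2M F g₁ g₂ g₃ ⟩
      d2Q ψ g₁ g₂ g₃                 ∎
      where open ≡-Reasoning

    ψ-cocycle : ∀ g₁ g₂ g₃ → Integral (d2Q ψ g₁ g₂ g₃)
    ψ-cocycle g₁ g₂ g₃ = d2M F g₁ g₂ g₃ H , sym (δF≡∂ψ g₁ g₂ g₃ H)

    module _ (F-res : ResTrivial F) where

      R : G → M
      R = proj₁ F-res

      K : G → G → G → ℤ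
      K g₁ g₂ g₃ = proj₁ (F-cocycle g₁ g₂ g₃)

      c⁻¹ : Cos → Cos
      c⁻¹ x = act (inv gc) x

      -- restricted to ⟨a⟩, X is a 1-cocycle up to constants (X-step), so summing over ⟨a⟩ telescopes
      X : G → M
      X h x = F gc h x - F h gc x - (R h (c⁻¹ x) - R h x)

      Kᵢ : ℕ → ℤ
      Kᵢ i = K gc (ga ^ i) ga - K (ga ^ i) gc ga + K (ga ^ i) ga gc

      F-res-at-aⁱ : ∀ i → IsConst (λ x → F (ga ^ i) ga x - d1M R (ga ^ i) ga x)
      F-res-at-aⁱ i = subst (λ h → IsConst (λ x → F h ga x - d1M R h ga x)) (sym (ga^≡aPow i)) (proj₂ F-res (red (+ i)) (red (+ 1)))

      X-step : ∀ i x → X ga (act (inv (ga ^ i)) x) - X ((ga ^ i) · ga) x + X (ga ^ i) x ≡ - Kᵢ i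
      X-step i x = combination
        (F h ga (c⁻¹ x)) (F gc (h · ga) x) (F gc h x) (F gc ga (a⁻ⁱ x)) (F h gc x) (F ga gc (a⁻ⁱ x)) (F (h · ga) gc x) (F h ga x)
        (R ga (a⁻ⁱ x)) (R (h · ga) x) (R h x) (R (h · ga) (c⁻¹ x)) (R h (c⁻¹ x))
        (F (h · gc) ga x) (F h (ga · gc) x) (R ga (c⁻¹ (a⁻ⁱ x)))
        (trans (cong (λ g → F h ga (c⁻¹ x) - F g ga x + F gc (h · ga) x - F gc h x) (sym (c·aⁱ≡aⁱ·c i))) (proj₂ (F-cocycle gc h ga) x))
        (trans (cong (λ g → F gc ga (a⁻ⁱ x) - F (h · gc) ga x + F h g x - F h gc x) (sym c·a≡a·c)) (proj₂ (F-cocycle h gc ga) x))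
        (proj₂ (F-cocycle h ga gc) x)
        (proj₂ (F-res-at-aⁱ i) x)
        (trans (cong (λ y → F h ga (c⁻¹ x) - (R ga y - R (h · ga) (c⁻¹ x) + R h (c⁻¹ x))) (sym a⁻ⁱc⁻¹≡c⁻¹a⁻ⁱ)) (proj₂ (F-res-at-aⁱ i) (c⁻¹ x)))
        where
        h = ga ^ i
        a⁻ⁱ = act (inv h)
        a⁻ⁱc⁻¹≡c⁻¹a⁻ⁱ : a⁻ⁱ (c⁻¹ x) ≡ c⁻¹ (a⁻ⁱ x)
        a⁻ⁱc⁻¹≡c⁻¹a⁻ⁱ = trans (act-inv-∘ gc h x) (trans (cong (λ g → act (inv g) x) (c·aⁱ≡aⁱ·c i)) (sym (act-inv-∘ h gc x)))
        -- the cocycle identities at (c,h,a), (h,c,a), (h,a,c) and the restriction identity at x and c⁻¹x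
        combination : ∀ A1 A2 A3 A4 A5 A6 A7 A8 B1 B2 B3 B5 B6 P1 P2 P3 {K1 K2 K3 κ} →
          A1 - P1 + A2 - A3 ≡ K1 → A4 - P1 + P2 - A5 ≡ K2 → A6 - A7 + P2 - A8 ≡ K3 →
          A8 - (B1 - B2 + B3) ≡ κ → A1 - (P3 - B5 + B6) ≡ κ →
          (A4 - A6 - (P3 - B1)) - (A2 - A7 - (B5 - B2)) + (A3 - A5 - (B6 - B3)) ≡ - (K1 - K2 + K3)
        combination A1 A2 A3 A4 A5 A6 A7 A8 B1 B2 B3 B5 B6 P1 P2 P3 {κ = κ} refl refl refl r₁ r₂ =
          trans (linear A1 A2 A3 A4 A5 A6 A7 A8 B1 B2 B3 B5 B6 P1 P2 P3)
                (trans (cong (_+_ (- ((A1 - P1 + A2 - A3) - (A4 - P1 + P2 - A5) + (A6 - A7 + P2 - A8)))) (trans (cong₂ _-_ r₂ r₁) (ℤ.+-inverseʳ κ)))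
                       (ℤ.+-identityʳ _))
          where
          linear : ∀ A1 A2 A3 A4 A5 A6 A7 A8 B1 B2 B3 B5 B6 P1 P2 P3 →
            (A4 - A6 - (P3 - B1)) - (A2 - A7 - (B5 - B2)) + (A3 - A5 - (B6 - B3))
            ≡ - ((A1 - P1 + A2 - A3) - (A4 - P1 + P2 - A5) + (A6 - A7 + P2 - A8)) + ((A1 - (P3 - B5 + B6)) - (A8 - (B1 - B2 + B3)))
          linear = solve-∀

      sum-X : ∀ x → sum< p (λ i → X ga (act (inv (ga ^ i)) x)) ≡ - sum< p Kᵢ
      sum-X x = begin
        sum< p (λ i → X ga (act (inv (ga ^ i)) x))   ≡⟨ sum<-cong p step ⟩
        sum< p (λ i → T (suc i) - T i - Kᵢ i)         ≡⟨ sum<-telescope p T Kᵢ ⟩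
        T p - T 0 - sum< p Kᵢ                         ≡⟨ cong (λ g → X g x - T 0 - sum< p Kᵢ) ga^p≡one ⟩
        T 0 - T 0 - sum< p Kᵢ                         ≡⟨ cancel (T 0) (sum< p Kᵢ) ⟩
        - sum< p Kᵢ                                   ∎
        where
        open ≡-Reasoning
        T : ℕ → ℤ
        T i = X (ga ^ i) x
        solve-for-first : ∀ u a b k → u - a + b ≡ - k → u ≡ a - b - k
        solve-for-first u a b k e = trans (rearrange u a b) (cong (_+_ (a - b)) e)
          where
          rearrange : ∀ u a b → u ≡ a - b + (u - a + b)
          rearrange = solve-∀
        step : ∀ i → X ga (act (inv (ga ^ i)) x) ≡ T (suc i) - T i - Kᵢ i
        step i = trans (solve-for-first _ _ (T i) (Kᵢ i) (X-step i x)) (cong (λ g → X g x - T i - Kᵢ i) (sym (^-sucʳ ga i)))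
        cancel : ∀ a s → a - a - s ≡ - s
        cancel = solve-∀

      ΣC-X : ΣC (X ga) ≡ + (p ℕ.* p) * X ga H
      ΣC-X = ℤ.*-cancelˡ-≡ (+ p) (ΣC (X ga)) (+ (p ℕ.* p) * X ga H) (begin
        + p * ΣC (X ga)                                              ≡⟨ sym (sum<-const p (ΣC (X ga))) ⟩
        sum< p (λ _ → ΣC (X ga))                                     ≡⟨ sum<-cong p (λ i → sym (ΣC-act (inv (ga ^ i)) (X ga))) ⟩
        sum< p (λ i → ΣC (λ x → X ga (act (inv (ga ^ i)) x)))        ≡⟨ sym (ΣC-sum< p (λ i x → X ga (act (inv (ga ^ i)) x))) ⟩
        ΣC (λ x → sum< p (λ i → X ga (act (inv (ga ^ i)) x)))        ≡⟨ ΣC-cong sum-X ⟩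
        ΣC (λ _ → - sum< p Kᵢ)                                       ≡⟨ ΣC-const _ ⟩
        + (p ℕ.* p) * - sum< p Kᵢ                                    ≡⟨ cong (+ (p ℕ.* p) *_) (sym (sum-X H)) ⟩
        + (p ℕ.* p) * sum< p (λ i → X ga (act (inv (ga ^ i)) H))     ≡⟨ cong (+ (p ℕ.* p) *_) (sum<-cong p (λ i → cong (X ga) (aⁱ-fixes-H i))) ⟩
        + (p ℕ.* p) * sum< p (λ _ → X ga H)                          ≡⟨ cong (+ (p ℕ.* p) *_) (sum<-const p (X ga H)) ⟩
        + (p ℕ.* p) * (+ p * X ga H)                                 ≡⟨ swap (+ (p ℕ.* p)) (+ p) (X ga H) ⟩
        + p * (+ (p ℕ.* p) * X ga H)                                 ∎)
        where
        open ≡-Reasoning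
        swap : ∀ a b c → a * (b * c) ≡ b * (a * c)
        swap = solve-∀

      ψ[c,a]-ψ[a,c]-integral : Integral (ψ gc ga ℚ.- ψ ga gc)
      ψ[c,a]-ψ[a,c]-integral = X ga H , (begin
        average (F gc ga) ℚ.- average (F ga gc)                       ≡⟨ distribute (fromℤ (ΣC (F gc ga))) (fromℤ (ΣC (F ga gc))) _ ⟩
        (fromℤ (ΣC (F gc ga)) ℚ.- fromℤ (ΣC (F ga gc))) ℚ.* (+ 1 / (p ℕ.* p))
          ≡⟨ cong (ℚ._* (+ 1 / (p ℕ.* p))) (sym (fromℤ-- (ΣC (F gc ga)) (ΣC (F ga gc)))) ⟩
        fromℤ (ΣC (F gc ga) - ΣC (F ga gc)) ℚ.* (+ 1 / (p ℕ.* p))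
          ≡⟨ cong (λ s → fromℤ s ℚ.* (+ 1 / (p ℕ.* p))) (sym (ΣC-- (F gc ga) (F ga gc))) ⟩
        average (λ x → F gc ga x - F ga gc x)                          ≡⟨ cong (λ s → fromℤ s ℚ.* (+ 1 / (p ℕ.* p))) ΣC-commutator ⟩
        fromℤ (+ (p ℕ.* p) * X ga H) ℚ.* (+ 1 / (p ℕ.* p))            ≡⟨ n*k/n≡k (p ℕ.* p) (X ga H) ⟩
        fromℤ (X ga H)                                                  ∎)
        where
        open ≡-Reasoning
        distribute : ∀ a b w → a ℚ.* w ℚ.- b ℚ.* w ≡ (a ℚ.- b) ℚ.* w
        distribute = RingSolver.solve-∀ ℚ-ring
        split : ∀ x → F gc ga x - F ga gc x ≡ X ga x + (R ga (c⁻¹ x) - R ga x)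
        split x = rearrange (F gc ga x) (F ga gc x) (R ga (c⁻¹ x)) (R ga x)
          where
          rearrange : ∀ a b c d → a - b ≡ a - b - (c - d) + (c - d)
          rearrange = solve-∀
        ΣC-commutator : ΣC (λ x → F gc ga x - F ga gc x) ≡ + (p ℕ.* p) * X ga H
        ΣC-commutator = begin
          ΣC (λ x → F gc ga x - F ga gc x)                            ≡⟨ ΣC-cong split ⟩
          ΣC (λ x → X ga x + (R ga (c⁻¹ x) - R ga x))                 ≡⟨ ΣC-+ (X ga) (λ x → R ga (c⁻¹ x) - R ga x) ⟩
          ΣC (X ga) + ΣC (λ x → R ga (c⁻¹ x) - R ga x)                ≡⟨ cong₂ _+_ ΣC-X (ΣC-- (λ x → R ga (c⁻¹ x)) (R ga)) ⟩
          + (p ℕ.* p) * X ga H + (ΣC (λ x → R ga (c⁻¹ x)) - ΣC (R ga)) ≡⟨ cong (λ s → + (p ℕ.* p) * X ga H + (s - ΣC (R ga))) (ΣC-act (inv gc) (R ga)) ⟩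
          + (p ℕ.* p) * X ga H + (ΣC (R ga) - ΣC (R ga))               ≡⟨ cong (_+_ (+ (p ℕ.* p) * X ga H)) (ℤ.+-inverseʳ (ΣC (R ga))) ⟩
          + (p ℕ.* p) * X ga H + + 0                                   ≡⟨ ℤ.+-identityʳ _ ⟩
          + (p ℕ.* p) * X ga H                                         ∎

-- Realising the multiples of [f₂]

module Cochains (p : ℕ) ⦃ nz : NonZero p ⦄ where
  open E p
  open Heisenberg p
  open import Data.Integer.Base using (_+_; _*_; -_; _-_)

  d2M-cong : ∀ {F F′ : G → G → M} → (∀ g₁ g₂ x → F g₁ g₂ x ≡ F′ g₁ g₂ x) →
             ∀ g₁ g₂ g₃ x → d2M F g₁ g₂ g₃ x ≡ d2M F′ g₁ g₂ g₃ x
  d2M-cong F≗F′ g₁ g₂ g₃ x =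
    cong₂ _-_ (cong₂ _+_ (cong₂ _-_ (F≗F′ g₂ g₃ _) (F≗F′ (g₁ · g₂) g₃ x)) (F≗F′ g₁ (g₂ · g₃) x)) (F≗F′ g₁ g₂ x)

  d2M-scale : ∀ k (F : G → G → M) g₁ g₂ g₃ x → d2M (λ g h y → k * F g h y) g₁ g₂ g₃ x ≡ k * d2M F g₁ g₂ g₃ x
  d2M-scale k F g₁ g₂ g₃ x = factor k (F g₂ g₃ (act (inv g₁) x)) (F (g₁ · g₂) g₃ x) (F g₁ (g₂ · g₃) x) (F g₁ g₂ x)
    where
    factor : ∀ k a b c d → k * a - k * b + k * c - k * d ≡ k * (a - b + c - d)
    factor = solve-∀

  -- G acts trivially on constants, and d2M ∘ d1M = 0
  d2M-const+d1M : ∀ (c : G → G → ℤ) (η : G → M) g₁ g₂ g₃ x →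
    d2M (λ g h y → c g h + d1M η g h y) g₁ g₂ g₃ x ≡ c g₂ g₃ - c (g₁ · g₂) g₃ + c g₁ (g₂ · g₃) - c g₁ g₂
  d2M-const+d1M c η g₁ g₂ g₃ x = begin
    c g₂ g₃ + (η g₃ (act (inv g₂) (act (inv g₁) x)) - η (g₂ · g₃) (act (inv g₁) x) + η g₂ (act (inv g₁) x))
    - (c (g₁ · g₂) g₃ + (η g₃ (act (inv (g₁ · g₂)) x) - η ((g₁ · g₂) · g₃) x + η (g₁ · g₂) x))
    + (c g₁ (g₂ · g₃) + (η (g₂ · g₃) (act (inv g₁) x) - η (g₁ · (g₂ · g₃)) x + η g₁ x))
    - (c g₁ g₂ + (η g₂ (act (inv g₁) x) - η (g₁ · g₂) x + η g₁ x))
      ≡⟨ cong₂ (λ y g → c g₂ g₃ + (η g₃ y - η (g₂ · g₃) (act (inv g₁) x) + η g₂ (act (inv g₁) x))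
                         - (c (g₁ · g₂) g₃ + (η g₃ (act (inv (g₁ · g₂)) x) - η g x + η (g₁ · g₂) x))
                         + (c g₁ (g₂ · g₃) + (η (g₂ · g₃) (act (inv g₁) x) - η (g₁ · (g₂ · g₃)) x + η g₁ x))
                         - (c g₁ g₂ + (η g₂ (act (inv g₁) x) - η (g₁ · g₂) x + η g₁ x)))
               (act-inv-∘ g₁ g₂ x) (·-assoc g₁ g₂ g₃) ⟩
    c g₂ g₃ + (X₁ - X₂ + X₃) - (c (g₁ · g₂) g₃ + (X₁ - X₄ + X₅)) + (c g₁ (g₂ · g₃) + (X₂ - X₄ + X₆)) - (c g₁ g₂ + (X₃ - X₅ + X₆))
      ≡⟨ cancel (c g₂ g₃) (c (g₁ · g₂) g₃) (c g₁ (g₂ · g₃)) (c g₁ g₂) X₁ X₂ X₃ X₄ X₅ X₆ ⟩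
    c g₂ g₃ - c (g₁ · g₂) g₃ + c g₁ (g₂ · g₃) - c g₁ g₂ ∎
    where
    open ≡-Reasoning
    X₁ = η g₃ (act (inv (g₁ · g₂)) x)
    X₂ = η (g₂ · g₃) (act (inv g₁) x)
    X₃ = η g₂ (act (inv g₁) x)
    X₄ = η (g₁ · (g₂ · g₃)) x
    X₅ = η (g₁ · g₂) x
    X₆ = η g₁ x
    cancel : ∀ c₁ c₂ c₃ c₄ X₁ X₂ X₃ X₄ X₅ X₆ →
      c₁ + (X₁ - X₂ + X₃) - (c₂ + (X₁ - X₄ + X₅)) + (c₃ + (X₂ - X₄ + X₆)) - (c₄ + (X₃ - X₅ + X₆)) ≡ c₁ - c₂ + c₃ - c₄
    cancel = solve-∀

module Realisation (p : ℕ) ⦃ nz : NonZero p ⦄ (half : ℕ) (p≡2half+1 : p ≡ suc (half ℕ.+ half)) where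
  open E p
  open Congruence (+ p)
  open Heisenberg p
  open Cochains p
  open import Data.Integer.Base using (_+_; _*_; -_; _-_)

  ½ : ℤ
  ½ = + suc half

  2*½≈1 : ∀ z → + 2 * (½ * z) ≈ z
  2*½≈1 z = mk≈ z (trans (expand (+ half) z) (cong (λ n → z + z * + n) (sym p≡2half+1)))
    where
    expand : ∀ h z → + 2 * ((+ 1 + h) * z) ≡ z + z * (+ 1 + (h + h))
    expand = solve-∀

  ½*2≈1 : ∀ z → ½ * (+ 2 * z) ≈ z
  ½*2≈1 z = ≈-trans (≈-reflexive (swap ½ z)) (2*½≈1 z)
    where
    swap : ∀ a z → a * (+ 2 * z) ≡ + 2 * (a * z)
    swap = solve-∀

  -- Q is an explicit solution of dQ = -2 f₂ in the integral model
  Qℤ : ℤ³ → ℤ² → ℤ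
  Qℤ (s , t , u) (τ , ν) = t * (ν + u + s * τ) - u * (+ 1 + τ)

  Qℤ-cong : ∀ {X X′ Y Y′} → X ≈³ X′ → Y ≈² Y′ → Qℤ X Y ≈ Qℤ X′ Y′
  Qℤ-cong (es , et , eu) (eτ , eν) = −-cong (*-cong et (+-cong (+-cong eν eu) (*-cong es eτ))) (*-cong eu (+-cong (≈-refl {+ 1}) eτ))

  2f₂ℤ : ℤ³ → ℤ³ → ℤ
  2f₂ℤ (s₁ , t₁ , u₁) (s₂ , t₂ , u₂) = t₁ * (t₁ - + 1) * s₂ + + 2 * ((t₁ * s₂ + u₁) * t₂)

  2f₂ℤ+dQℤ≡0 : ∀ X Y x → 2f₂ℤ X Y + Qℤ Y (actℤ³ (invℤ³ X) x) - Qℤ (mulℤ³ X Y) x + Qℤ X x ≡ + 0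
  2f₂ℤ+dQℤ≡0 (a , b , c) (d , e , f) (τ , ν) = identity a b c d e f τ ν
    where
    identity : ∀ a b c d e f τ ν →
      b * (b - + 1) * d + + 2 * ((b * d + c) * e)
      + (e * ((ν + (b * a - c) - (- b + τ) * (- a)) + f + d * (- b + τ)) - f * (+ 1 + (- b + τ)))
      - ((b + e) * (ν + (c + f + b * d) + (a + d) * τ) - (c + f + b * d) * (+ 1 + τ))
      + (b * (ν + c + a * τ) - c * (+ 1 + τ)) ≡ + 0
    identity = solve-∀

  2*f₂-numerator : ∀ g₁ g₂ → + 2 * + f₂-numerator g₁ g₂ ≡ 2f₂ℤ ⌊ g₁ ⌋ ⌊ g₂ ⌋
  2*f₂-numerator (s₁ , t₁ , u₁) (s₂ , t₂ , u₂) = begin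
    + 2 * + (T ℕ.* S₂ ℕ.+ (T₁ ℕ.* S₂ ℕ.+ U₁) ℕ.* T₂)
      ≡⟨ cong (+ 2 *_) (trans (ℤ.pos-+ (T ℕ.* S₂) _) (cong₂ _+_ (ℤ.pos-* T S₂)
           (trans (ℤ.pos-* (T₁ ℕ.* S₂ ℕ.+ U₁) T₂) (cong (_* + T₂) (trans (ℤ.pos-+ (T₁ ℕ.* S₂) U₁) (cong (_+ + U₁) (ℤ.pos-* T₁ S₂))))))) ⟩
    + 2 * (+ T * + S₂ + (+ T₁ * + S₂ + + U₁) * + T₂)
      ≡⟨ distribute (+ T) (+ S₂) (+ T₁) (+ U₁) (+ T₂) ⟩
    + 2 * + T * + S₂ + + 2 * ((+ T₁ * + S₂ + + U₁) * + T₂)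
      ≡⟨ cong (λ n → n * + S₂ + + 2 * ((+ T₁ * + S₂ + + U₁) * + T₂)) (2*tri T₁) ⟩
    2f₂ℤ ⌊ s₁ , t₁ , u₁ ⌋ ⌊ s₂ , t₂ , u₂ ⌋ ∎
    where
    open ≡-Reasoning
    S₂ = toℕ s₂ ; T₁ = toℕ t₁ ; U₁ = toℕ u₁ ; T₂ = toℕ t₂ ; T = tri T₁
    distribute : ∀ r s t u v → + 2 * (r * s + (t * s + u) * v) ≡ + 2 * r * s + + 2 * ((t * s + u) * v)
    distribute = solve-∀

  η : G → M
  η g x = ½ * Qℤ ⌊ g ⌋ ⌊ x ⌋ᶜ

  numerator : G → G → M
  numerator g₁ g₂ x = + f₂-numerator g₁ g₂ + d1M η g₁ g₂ x

  numerator≈0 : ∀ g₁ g₂ x → numerator g₁ g₂ x ≈ + 0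
  numerator≈0 g₁ g₂ x = begin
    numerator g₁ g₂ x                                           ≈⟨ ≈-sym (½*2≈1 _) ⟩
    ½ * (+ 2 * numerator g₁ g₂ x)                               ≈⟨ *-cong (≈-refl {½}) twice ⟩
    ½ * + 0                                                     ≡⟨ ℤ.*-zeroʳ ½ ⟩
    + 0                                                         ∎
    where
    open SetoidReasoning ≈-setoid
    Q₁ = Qℤ ⌊ g₂ ⌋ ⌊ act (inv g₁) x ⌋ᶜ
    Q₂ = Qℤ ⌊ g₁ · g₂ ⌋ ⌊ x ⌋ᶜ
    Q₃ = Qℤ ⌊ g₁ ⌋ ⌊ x ⌋ᶜ
    distribute : ∀ f a b c → + 2 * (f + (½ * a - ½ * b + ½ * c)) ≡ + 2 * f + + 2 * (½ * a) - + 2 * (½ * b) + + 2 * (½ * c)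
    distribute = solve-∀
    twice : + 2 * numerator g₁ g₂ x ≈ + 0
    twice = begin
      + 2 * numerator g₁ g₂ x
        ≡⟨ distribute (+ f₂-numerator g₁ g₂) Q₁ Q₂ Q₃ ⟩
      + 2 * + f₂-numerator g₁ g₂ + + 2 * (½ * Q₁) - + 2 * (½ * Q₂) + + 2 * (½ * Q₃)
        ≈⟨ +-cong (−-cong (+-cong (≈-reflexive (2*f₂-numerator g₁ g₂)) (2*½≈1 Q₁)) (2*½≈1 Q₂)) (2*½≈1 Q₃) ⟩
      2f₂ℤ ⌊ g₁ ⌋ ⌊ g₂ ⌋ + Q₁ - Q₂ + Q₃
        ≈⟨ +-cong (−-cong (+-cong (≈-refl {2f₂ℤ ⌊ g₁ ⌋ ⌊ g₂ ⌋})
                                   (Qℤ-cong (≈³-refl {⌊ g₂ ⌋}) (⌊act⌋ (⌊inv⌋ (≈³-refl {⌊ g₁ ⌋})) (≈²-refl {⌊ x ⌋ᶜ}))))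
                          (Qℤ-cong (⌊·⌋ {g₁} {g₂} ≈³-refl ≈³-refl) (≈²-refl {⌊ x ⌋ᶜ})))
                 (≈-refl {Q₃}) ⟩
      2f₂ℤ ⌊ g₁ ⌋ ⌊ g₂ ⌋ + Qℤ ⌊ g₂ ⌋ (actℤ³ (invℤ³ ⌊ g₁ ⌋) ⌊ x ⌋ᶜ) - Qℤ (mulℤ³ ⌊ g₁ ⌋ ⌊ g₂ ⌋) ⌊ x ⌋ᶜ + Q₃
        ≡⟨ 2f₂ℤ+dQℤ≡0 ⌊ g₁ ⌋ ⌊ g₂ ⌋ ⌊ x ⌋ᶜ ⟩
      + 0 ∎

  η-vanishes-on-H : ∀ i x → η (aPow i) x ≡ + 0
  η-vanishes-on-H i (τ , ν) = trans (cong (λ z → ½ * Qℤ (I i , + z , + z) (I τ , I ν)) toℕ-red-0) (vanish ½ (I i) (I τ) (I ν))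
    where
    vanish : ∀ h s τ ν → h * (+ 0 * (ν + + 0 + s * τ) - + 0 * (+ 1 + τ)) ≡ + 0
    vanish = solve-∀

  numerator-vanishes-on-H : ∀ i j x → numerator (aPow i) (aPow j) x ≡ + 0
  numerator-vanishes-on-H i j x = begin
    + f₂-numerator (aPow i) (aPow j) + (η (aPow j) (act (inv (aPow i)) x) - η (aPow i · aPow j) x + η (aPow i) x)
      ≡⟨ cong₂ (λ z g → + (tri z ℕ.* toℕ j ℕ.+ (z ℕ.* toℕ j ℕ.+ z) ℕ.* z) + (η (aPow j) (act (inv (aPow i)) x) - η g x + η (aPow i) x))
               toℕ-red-0 (aPow-· i j) ⟩
    + 0 + (η (aPow j) (act (inv (aPow i)) x) - η (aPow (red (I i + I j))) x + η (aPow i) x)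
      ≡⟨ cong₂ (λ a b → + 0 + (a - b + η (aPow i) x)) (η-vanishes-on-H j _) (η-vanishes-on-H (red (I i + I j)) x) ⟩
    + 0 + (+ 0 - + 0 + η (aPow i) x)
      ≡⟨ cong (λ c → + 0 + (+ 0 - + 0 + c)) (η-vanishes-on-H i x) ⟩
    + 0 ∎
    where open ≡-Reasoning

  F₁ : G → G → M
  F₁ g₁ g₂ x = numerator g₁ g₂ x /ℕ p

  p*F₁≡numerator : ∀ g₁ g₂ x → + p * F₁ g₁ g₂ x ≡ numerator g₁ g₂ x
  p*F₁≡numerator g₁ g₂ x = ≈0⇒p∣ (numerator g₁ g₂ x) (numerator≈0 g₁ g₂ x)

  δf₂-numerator : G → G → G → ℤ
  δf₂-numerator g₁ g₂ g₃ = + f₂-numerator g₂ g₃ - + f₂-numerator (g₁ · g₂) g₃ + + f₂-numerator g₁ (g₂ · g₃) - + f₂-numerator g₁ g₂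

  p*d2M-F₁ : ∀ g₁ g₂ g₃ x → + p * d2M F₁ g₁ g₂ g₃ x ≡ δf₂-numerator g₁ g₂ g₃
  p*d2M-F₁ g₁ g₂ g₃ x = begin
    + p * d2M F₁ g₁ g₂ g₃ x                         ≡⟨ sym (d2M-scale (+ p) F₁ g₁ g₂ g₃ x) ⟩
    d2M (λ g h y → + p * F₁ g h y) g₁ g₂ g₃ x       ≡⟨ d2M-cong p*F₁≡numerator g₁ g₂ g₃ x ⟩
    d2M numerator g₁ g₂ g₃ x                        ≡⟨ d2M-const+d1M (λ g h → + f₂-numerator g h) η g₁ g₂ g₃ x ⟩
    δf₂-numerator g₁ g₂ g₃                          ∎
    where open ≡-Reasoning

  Fₖ : ℕ → G → G → M
  Fₖ k g₁ g₂ x = + k * F₁ g₁ g₂ x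

  Fₖ-cocycle : ∀ k → JCocycle (Fₖ k)
  Fₖ-cocycle k g₁ g₂ g₃ = + k * d2M F₁ g₁ g₂ g₃ H , λ x →
    trans (d2M-scale (+ k) F₁ g₁ g₂ g₃ x)
          (cong (+ k *_) (ℤ.*-cancelˡ-≡ (+ p) _ _ (trans (p*d2M-F₁ g₁ g₂ g₃ x) (sym (p*d2M-F₁ g₁ g₂ g₃ H)))))

  Fₖ-res : ∀ k → ResTrivial (Fₖ k)
  Fₖ-res k = (λ _ _ → + 0) , λ i j → + 0 , λ x →
    trans (cong (λ n → + k * (n /ℕ p) - + 0) (numerator-vanishes-on-H i j x))
          (trans (cong (λ q → + k * + q - + 0) (ℕ.0/n≡0 p)) (vanish (+ k)))
    where
    vanish : ∀ k → k * + 0 - + 0 ≡ + 0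
    vanish = solve-∀

  Fₖ↦k·f₂ : ∀ k → MapsTo (Fₖ k) (scale k f₂)
  Fₖ↦k·f₂ k = scale k f₂ , ((λ _ → ℚ.0ℚ) , λ g₁ g₂ → subst Integral (sym (cancel (scale k f₂ g₁ g₂))) integral-0) , δFₖ≡∂[k·f₂]
    where
    cancel : ∀ a → a ℚ.- a ℚ.- (ℚ.0ℚ ℚ.- ℚ.0ℚ ℚ.+ ℚ.0ℚ) ≡ ℚ.0ℚ
    cancel = RingSolver.solve-∀ ℚ-ring
    w = + 1 / p
    distribute : ∀ K a b c d w → K ℚ.* ((a ℚ.- b ℚ.+ c ℚ.- d) ℚ.* w) ≡ K ℚ.* (a ℚ.* w) ℚ.- K ℚ.* (b ℚ.* w) ℚ.+ K ℚ.* (c ℚ.* w) ℚ.- K ℚ.* (d ℚ.* w)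
    distribute = RingSolver.solve-∀ ℚ-ring
    δFₖ≡∂[k·f₂] : ∀ g₁ g₂ g₃ x → d2M (Fₖ k) g₁ g₂ g₃ x ℚ./ 1 ≡ d2Q (scale k f₂) g₁ g₂ g₃
    δFₖ≡∂[k·f₂] g₁ g₂ g₃ x = begin
      fromℤ (d2M (Fₖ k) g₁ g₂ g₃ x)                               ≡⟨ cong fromℤ (d2M-scale (+ k) F₁ g₁ g₂ g₃ x) ⟩
      fromℤ (+ k * d2M F₁ g₁ g₂ g₃ x)                             ≡⟨ fromℤ-* (+ k) _ ⟩
      fromℤ (+ k) ℚ.* fromℤ (d2M F₁ g₁ g₂ g₃ x)                   ≡⟨ cong (fromℤ (+ k) ℚ.*_) (sym (n*k/n≡k p _)) ⟩
      fromℤ (+ k) ℚ.* (fromℤ (+ p * d2M F₁ g₁ g₂ g₃ x) ℚ.* w)     ≡⟨ cong (λ z → fromℤ (+ k) ℚ.* (fromℤ z ℚ.* w)) (p*d2M-F₁ g₁ g₂ g₃ x) ⟩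
      fromℤ (+ k) ℚ.* (fromℤ (δf₂-numerator g₁ g₂ g₃) ℚ.* w)      ≡⟨ cong (λ z → fromℤ (+ k) ℚ.* (z ℚ.* w)) (fromℤ-alternating (+ f₂-numerator g₂ g₃) (+ f₂-numerator (g₁ · g₂) g₃) (+ f₂-numerator g₁ (g₂ · g₃)) (+ f₂-numerator g₁ g₂)) ⟩
      fromℤ (+ k) ℚ.* ((N g₂ g₃ ℚ.- N (g₁ · g₂) g₃ ℚ.+ N g₁ (g₂ · g₃) ℚ.- N g₁ g₂) ℚ.* w)
        ≡⟨ distribute (fromℤ (+ k)) (N g₂ g₃) (N (g₁ · g₂) g₃) (N g₁ (g₂ · g₃)) (N g₁ g₂) w ⟩
      fromℤ (+ k) ℚ.* (N g₂ g₃ ℚ.* w) ℚ.- fromℤ (+ k) ℚ.* (N (g₁ · g₂) g₃ ℚ.* w)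
        ℚ.+ fromℤ (+ k) ℚ.* (N g₁ (g₂ · g₃) ℚ.* w) ℚ.- fromℤ (+ k) ℚ.* (N g₁ g₂ ℚ.* w)
        ≡⟨ sym (cong₂ ℚ._-_ (cong₂ ℚ._+_ (cong₂ ℚ._-_ (k·f₂ g₂ g₃) (k·f₂ (g₁ · g₂) g₃)) (k·f₂ g₁ (g₂ · g₃))) (k·f₂ g₁ g₂)) ⟩
      d2Q (scale k f₂) g₁ g₂ g₃                                   ∎
      where
      open ≡-Reasoning
      N : G → G → ℚ
      N g h = fromℤ (+ f₂-numerator g h)
      k·f₂ : ∀ g h → scale k f₂ g h ≡ fromℤ (+ k) ℚ.* (N g h ℚ.* w)
      k·f₂ g h = cong (fromℤ (+ k) ℚ.*_) (f₂≡numerator/p g h)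

-- The order of [f₂]

module OrderOfF₂ (p : ℕ) ⦃ nz : NonZero p ⦄ where
  open E p
  open Heisenberg p
  open import Data.Rational.Base using (_+_; _-_; _*_; 0ℚ)

  p·f₂-trivial : SameClassQZ (scale p f₂) zeroQ
  p·f₂-trivial = (λ _ → 0ℚ) , λ g₁ g₂ → + f₂-numerator g₁ g₂ , (begin
    fromℤ (+ p) * f₂ g₁ g₂ - 0ℚ - (0ℚ - 0ℚ + 0ℚ)              ≡⟨ cong (λ f → fromℤ (+ p) * f - 0ℚ - (0ℚ - 0ℚ + 0ℚ)) (f₂≡numerator/p g₁ g₂) ⟩
    fromℤ (+ p) * (fromℤ (+ f₂-numerator g₁ g₂) * (+ 1 / p)) - 0ℚ - (0ℚ - 0ℚ + 0ℚ)
      ≡⟨ rearrange (fromℤ (+ p)) (fromℤ (+ f₂-numerator g₁ g₂)) (+ 1 / p) ⟩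
    fromℤ (+ f₂-numerator g₁ g₂) * ((+ 1 / p) * fromℤ (+ p))  ≡⟨ cong (fromℤ (+ f₂-numerator g₁ g₂) *_) (1/d*d≡1 p) ⟩
    fromℤ (+ f₂-numerator g₁ g₂) * ℚ.1ℚ                       ≡⟨ ℚ.*-identityʳ _ ⟩
    fromℤ (+ f₂-numerator g₁ g₂)                              ∎)
    where
    open ≡-Reasoning
    rearrange : ∀ P N w → P * (N * w) - 0ℚ - (0ℚ - 0ℚ + 0ℚ) ≡ N * (w * P)
    rearrange = RingSolver.solve-∀ ℚ-ring

  -- c and b commute, so any coboundary takes the same value on (c,b) and (b,c), whereas f₂ does not
  f₂-nontrivial : 1 ℕ.< p → ¬ SameClassQZ f₂ zeroQ
  f₂-nontrivial 1<p (h , f₂-dh-integral) =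
    1/d-not-integral p 1<p (subst Integral commutator (integral-- (f₂-dh-integral gc gb) (f₂-dh-integral gb gc)))
    where
    open ≡-Reasoning
    N[c,b]≡1 : f₂-numerator gc gb ≡ 1
    N[c,b]≡1 = cong₂ (λ z o → tri z ℕ.* z ℕ.+ (z ℕ.* z ℕ.+ o) ℕ.* o) toℕ-red-0 (toℕ-red-+ 1 1<p)
    N[b,c]≡0 : f₂-numerator gb gc ≡ 0
    N[b,c]≡0 = cong₂ (λ z o → tri o ℕ.* z ℕ.+ (o ℕ.* z ℕ.+ z) ℕ.* z) toℕ-red-0 (toℕ-red-+ 1 1<p)
    rearrange : ∀ x y a b c → (x - 0ℚ - (a - b + c)) - (y - 0ℚ - (c - b + a)) ≡ x - y
    rearrange = RingSolver.solve-∀ ℚ-ring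
    evaluate : ∀ w → ℚ.1ℚ * w - 0ℚ * w ≡ w
    evaluate = RingSolver.solve-∀ ℚ-ring
    commutator : (f₂ gc gb - 0ℚ - d1Q h gc gb) - (f₂ gb gc - 0ℚ - d1Q h gb gc) ≡ + 1 / p
    commutator = begin
      (f₂ gc gb - 0ℚ - (h gb - h (gc · gb) + h gc)) - (f₂ gb gc - 0ℚ - (h gc - h (gb · gc) + h gb))
        ≡⟨ cong (λ g → (f₂ gc gb - 0ℚ - (h gb - h g + h gc)) - (f₂ gb gc - 0ℚ - (h gc - h (gb · gc) + h gb))) c·b≡b·c ⟩
      (f₂ gc gb - 0ℚ - (h gb - h (gb · gc) + h gc)) - (f₂ gb gc - 0ℚ - (h gc - h (gb · gc) + h gb))
        ≡⟨ rearrange (f₂ gc gb) (f₂ gb gc) (h gb) (h (gb · gc)) (h gc) ⟩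
      f₂ gc gb - f₂ gb gc
        ≡⟨ cong₂ _-_ (trans (f₂≡numerator/p gc gb) (cong (λ n → fromℤ (+ n) * (+ 1 / p)) N[c,b]≡1))
                     (trans (f₂≡numerator/p gb gc) (cong (λ n → fromℤ (+ n) * (+ 1 / p)) N[b,c]≡0)) ⟩
      ℚ.1ℚ * (+ 1 / p) - 0ℚ * (+ 1 / p)
        ≡⟨ evaluate (+ 1 / p) ⟩
      + 1 / p ∎

proposition2p15 : (p : ℕ) ⦃ nz : NonZero p ⦄ → Prime p → 3 ≤ p →
    let open E p in
      -- the image of Ker(res) under ∂⁻¹∘δ is contained in ⟨[f₂]⟩
      (∀ (F : G → G → M) → JCocycle F → ResTrivial F →
        ∃ λ (k : ℕ) → MapsTo F (scale k f₂))
      -- and contains all of ⟨[f₂]⟩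
      × (∀ (k : ℕ) → ∃ λ (F : G → G → M) →
          JCocycle F × ResTrivial F × MapsTo F (scale k f₂))
      -- ⟨[f₂]⟩ ≃ Z/pZ : [f₂] ≠ 0 and p·[f₂] = 0
      × ¬ SameClassQZ f₂ zeroQ
      × SameClassQZ (scale p f₂) zeroQ
proposition2p15 p p-prime 3≤p with prime≥3⇒odd p-prime 3≤p
... | half , p≡2half+1 =
  (λ F F-cocycle F-res → let (k , class) = classify half (tri-odd {h = half} p≡2half+1) (ψ F F-cocycle) (ψ-cocycle F F-cocycle)
                                                    (ψ[c,a]-ψ[a,c]-integral F F-cocycle F-res)
                         in k , ψ F F-cocycle , class , δF≡∂ψ F F-cocycle) ,
  (λ k → Fₖ k , Fₖ-cocycle k , Fₖ-res k , Fₖ↦k·f₂ k) ,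
  f₂-nontrivial (ℕ.<-≤-trans (ℕ.s≤s (ℕ.s≤s ℕ.z≤n)) 3≤p) ,
  p·f₂-trivial
  where
  open Classification p
  open RestrictionKernel p
  open Realisation p half p≡2half+1
  open OrderOfF₂ p
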